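{- Let $q$ be a power of an odd prime with $q\equiv 7\pmod 8$, and let $F=F_{2,\frac13}(x)=x^2\big(1+\frac13\eta(x)\big)$ over $\mathbb{F}_q$. Then for any $b\in\mathbb{F}_q$, $\delta_F(1,b)\le 3$. Moreover, $\delta_F(1,b)=3$ if and only if one of the following holds: (1) $\#A_{10}(b)=2$ and $\#A_{11}(b)=1$ (in which case $\#A_{00}(b)=\#A_{01}(b)=0$); (2) $\#A_{00}(b)=\#A_{11}(b)=\#A_{10}(b)=1$ (in which case $\#A_{01}(b)=0$).
   Context: $\eta$ is the quadratic character of $\mathbb{F}_q$ ($\eta(0)=0$, $\eta=1$ on nonzero squares, $-1$ on non-squares). $C_{00}=\{x:\eta(x)=\eta(x+1)=1\}$, $C_{01}=\{x:\eta(x)=1,\eta(x+1)=-1\}$, $C_{10}=\{x:\eta(x)=-1,\eta(x+1)=1\}$, $C_{11}=\{x:\eta(x)=\eta(x+1)=-1\}$. For $i,j\in\{0,1\}$, $A_{ij}(b)=\{x\in C_{ij}: F(x+1)-F(x)=b\}$. $\delta_F(1,b)=\#\{x\in\mathbb{F}_q: F(x+1)-F(x)=b\}$. -}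

module Defs where

open import Level using (Level; 0ℓ)
open import Data.Nat using (ℕ)
open import Data.Integer using (ℤ; +_; -[1+_])
open import Data.Fin using (Fin)
open import Data.Fin.Properties using (any?)
open import Data.List using (List; length; filter; map; allFin)
open import Data.Product using (Σ; ∃; _,_; proj₁)
open import Relation.Nullary using (Dec; yes; no; ¬_)
open import Relation.Unary using (Pred; Decidable)
open import Relation.Binary.PropositionalEquality using (_≡_; _≢_; refl; sym; trans; cong)
open import Function.Bundles using (_↔_; Inverse)
open import Algebra.Structures using (IsCommutativeRing)

record FiniteField : Set₁ where
  infixl 7 _*_
  infixl 6 _+_ _-_
  infix 4 _≟_
  field
    Carrier : Set
    _+_ _*_ : Carrier → Carrier → Carrier
    -_      : Carrier → Carrier
    0# 1#   : Carrier
    isCommutativeRing : IsCommutativeRing _≡_ _+_ _*_ -_ 0# 1#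
    _⁻¹     : Carrier → Carrier
    ⁻¹-inverse : ∀ x → x ≢ 0# → x * (x ⁻¹) ≡ 1#
    0≢1     : 0# ≢ 1#
    _≟_     : (x y : Carrier) → Dec (x ≡ y)
    q       : ℕ
    enum    : Fin q ↔ Carrier

  _-_ : Carrier → Carrier → Carrier
  x - y = x + (- y)

  elt : Fin q → Carrier
  elt = Inverse.to enum

  idx : Carrier → Fin q
  idx = Inverse.from enum

  count : {P : Pred Carrier 0ℓ} → Decidable P → ℕ
  count P? = length (filter (λ i → P? (elt i)) (allFin q))

  IsSquare : Carrier → Set
  IsSquare x = ∃ λ y → y * y ≡ x

  isSquare? : (x : Carrier) → Dec (IsSquare x)
  isSquare? x with any? (λ i → elt i * elt i ≟ x)
  ... | yes (i , e) = yes (elt i , e)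
  ... | no ¬p = no λ { (y , e) → ¬p (idx y , trans (cong (λ z → z * z) (Inverse.strictlyInverseˡ enum y)) e) }

  η : Carrier → ℤ
  η x with x ≟ 0#
  ... | yes _ = + 0
  ... | no _ with isSquare? x
  ...   | yes _ = + 1
  ...   | no _  = -[1+ 0 ]

  -- the image of an integer in {-1,0,1} in the field (used for η(x) ∈ F_q)
  ι : ℤ → Carrier
  ι (+ 0)         = 0#
  ι (+ ℕ.suc _)   = 1#
  ι -[1+ _ ]      = - 1#

  3# : Carrier
  3# = 1# + 1# + 1#

  F : Carrier → Carrier
  F x = x * x * (1# + (3# ⁻¹) * ι (η x))

  δF : Carrier → ℕ
  δF b = count (λ x → F (x + 1#) - F x ≟ b)

  -- #A_{ij}(b) where C_{ij} = {x : η(x) = ε_i, η(x+1) = ε_j}, ε_0 = 1, ε_1 = -1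
  #A : ℤ → ℤ → Carrier → ℕ
  #A e₀ e₁ b = count P?
    where
    P? : (x : Carrier) → Dec (η x ≡ e₀ Data.Product.× η (x + 1#) ≡ e₁ Data.Product.× F (x + 1#) - F x ≡ b)
    P? x with Data.Integer._≟_ (η x) e₀ | Data.Integer._≟_ (η (x + 1#)) e₁ | F (x + 1#) - F x ≟ b
    ... | yes p | yes r | yes s = yes (p , r , s)
    ... | no ¬p | _ | _ = no λ { (p , _ , _) → ¬p p }
    ... | yes _ | no ¬r | _ = no λ { (_ , r , _) → ¬r r }
    ... | yes _ | yes _ | no ¬s = no λ { (_ , _ , s) → ¬s s }

  #A00 #A01 #A10 #A11 : Carrier → ℕ
  #A00 = #A (+ 1) (+ 1)
  #A01 = #A (+ 1) -[1+ 0 ]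
  #A10 = #A -[1+ 0 ] (+ 1)
  #A11 = #A -[1+ 0 ] -[1+ 0 ]

module Submission where

-- Outside {0, -1}, the pair (η x, η (x + 1)) puts x into one of the classes C_ij, and on C_ij the
-- difference F (x + 1) - F x equals (2/3) · E_ij(x) for an explicit polynomial: E00 = 4x + 2,
-- E11 = 2x + 1, E01 = 2 - (x - 1)² and E10 = (x + 2)² - 2. Hence each linear class has at most one
-- solution and each quadratic class at most two, and two solutions in the same quadratic class are
-- mirror images (x₁ - 1 = 1 - x₂, resp. y₁ + 2 = -(y₂ + 2)). When q ≡ 7 (mod 8), -1 is a non-square
-- and 2 is a square; then almost every coincidence of values between classes (or with the values at
-- 0 and -1) would exhibit -1, or 2 times a non-square, as a square. What survives this table of
-- exclusions has at most three solutions, and exactly three only in the two stated configurations.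
-- The two facts about -1 and 2 are parity arguments: q - 1 = 2 · #squares, and fixed-point-free
-- involutions (negation on the squares if -1 were a square; t ↦ t⁻¹ and a Cayley-transform involution
-- on the squares ≠ 1 if 2 were not) would make q - 1 divisible by 4, resp. q ≡ 3 (mod 8).

open import Defs
open import Level using (0ℓ)
open import Algebra.Bundles using (CommutativeRing)
import Algebra.Solver.Ring
open import Algebra.Solver.Ring.AlmostCommutativeRing using (fromCommutativeRing; _-Raw-AlmostCommutative⟶_)
open import Data.Bool using (Bool; true; false; _xor_)
open import Data.Empty using (⊥; ⊥-elim)
open import Data.Fin as Fin using (Fin)
import Data.Fin.Properties as Finₚ
import Data.Integer as ℤ
import Data.Integer.Properties as ℤₚ
open import Data.List using (List; []; _∷_; length; filter; allFin; tabulate)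
open import Data.List.Properties using (length-tabulate; filter-none; filter-all)
open import Data.List.Relation.Unary.All.Properties using (tabulate⁺)
import Data.Maybe as Maybe
open import Data.Nat as ℕ using (ℕ; zero; suc; _≤_; z≤n; s≤s; _%_; _/_; NonZero)
open import Data.Nat.DivMod using (m≡m%n+[m/n]*n; [m+kn]%n≡m%n)
import Data.Nat.Properties as ℕₚ
open import Data.Nat.Tactic.RingSolver using (solve-∀)
open import Data.Product using (Σ; ∃; ∃₂; _,_; _×_; proj₁; proj₂; map₂)
open import Data.Sign as Sign using (Sign)
open import Data.Sum using (_⊎_; inj₁; inj₂; [_,_]′)
open import Function using (_∘_; id)
open import Function.Bundles using (Inverse; _⇔_; mk⇔)
open import Relation.Binary.Consequences using (dec⇒weaklyDec)
open import Relation.Binary.Definitions using (tri<; tri≈; tri>)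
import Relation.Binary.PropositionalEquality as ≡
open ≡ using (_≡_; _≢_)
open import Relation.Nullary using (yes; no; ¬_)
open import Relation.Nullary.Decidable using (_×-dec_)
open import Relation.Unary using (Pred; Decidable; U; _∩_; ∁; _⊆_)
open import Relation.Unary.Properties using (_∩?_; _∪?_; ∁?; U?)

module SevenModEight {q : ℕ} (q≡7 : q % 8 ≡ 7) where
  open import Data.Nat using (_+_; _*_)
  open ≡ using (sym; trans; cong)

  private
    q≡7+8k : q ≡ 7 + (q / 8) * 8
    q≡7+8k = trans (m≡m%n+[m/n]*n q 8) (cong (_+ (q / 8) * 8) q≡7)

    same-residue : ∀ r s a b n .{{_ : NonZero n}} → r + a * n ≡ s + b * n → r % n ≡ s % n
    same-residue r s a b n e = trans (sym ([m+kn]%n≡m%n r a n)) (trans (cong (_% n) e) ([m+kn]%n≡m%n s b n))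

  q≢2k : ∀ k → q ≢ 2 * k
  q≢2k k e with same-residue 1 0 (3 + q / 8 * 4) k 2 (trans (7+8m (q / 8)) (trans (sym q≡7+8k) (trans e (k-form k))))
    where
    7+8m : ∀ m → 1 + (3 + m * 4) * 2 ≡ 7 + m * 8
    7+8m = solve-∀
    k-form : ∀ k → 2 * k ≡ 0 + k * 2
    k-form = solve-∀
  ... | ()

  q≢1+4k : ∀ k → q ≢ 1 + 2 * (2 * k)
  q≢1+4k k e with same-residue 3 1 (1 + q / 8 * 2) k 4 (trans (7+8m (q / 8)) (trans (sym q≡7+8k) (trans e (k-form k))))
    where
    7+8m : ∀ m → 3 + (1 + m * 2) * 4 ≡ 7 + m * 8
    7+8m = solve-∀
    k-form : ∀ k → 1 + 2 * (2 * k) ≡ 1 + k * 4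
    k-form = solve-∀
  ... | ()

  q≢3+8k : ∀ k → q ≢ 1 + 2 * (1 + 2 * (2 * k))
  q≢3+8k k e with same-residue 7 3 (q / 8) k 8 (trans (sym q≡7+8k) (trans e (k-form k)))
    where
    k-form : ∀ k → 1 + 2 * (1 + 2 * (2 * k)) ≡ 3 + k * 8
    k-form = solve-∀
  ... | ()

-- Algebra.Solver.Ring decides identities by computing with coefficients, so these must have a computable
-- equality; the field's own equality is not computable, but ℤ maps into every commutative ring.
module IntegerCoefficientSolver {c ℓ} (R : CommutativeRing c ℓ) where

  open CommutativeRing R
  open import Data.Integer using (ℤ; +_; -[1+_]; _⊖_; _◃_; sign; ∣_∣)
  open import Algebra.Properties.Ring ring using (-1*x≈-x; -‿involutive; -‿+-comm; -0#≈0#)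
  open import Algebra.Properties.CommutativeSemigroup *-commutativeSemigroup using (interchange)
  import Algebra.Properties.Semiring.Mult.TCOptimised semiring as Mult
  open import Relation.Binary.Reasoning.Setoid setoid

  ⟦_⟧ℤ : ℤ → Carrier
  ⟦ + n ⟧ℤ     = n Mult.× 1#
  ⟦ -[1+ n ] ⟧ℤ = - (suc n Mult.× 1#)

  private
    sign-value : Sign → Carrier
    sign-value Sign.+ = 1#
    sign-value Sign.- = - 1#

    1+x-[1+y]≈x-y : ∀ x y → (1# + x) - (1# + y) ≈ x - y
    1+x-[1+y]≈x-y x y = begin
      (1# + x) - (1# + y)       ≈⟨ +-cong (+-comm 1# x) (sym (-‿+-comm 1# y)) ⟩
      (x + 1#) + (- 1# + - y)   ≈⟨ +-assoc x 1# _ ⟩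
      x + (1# + (- 1# + - y))   ≈⟨ +-congˡ (sym (+-assoc 1# (- 1#) (- y))) ⟩
      x + ((1# - 1#) + - y)     ≈⟨ +-congˡ (+-congʳ (-‿inverseʳ 1#)) ⟩
      x + (0# + - y)            ≈⟨ +-congˡ (+-identityˡ (- y)) ⟩
      x - y                     ∎

    ⊖-homo : ∀ m n → ⟦ m ⊖ n ⟧ℤ ≈ m Mult.× 1# - n Mult.× 1#
    ⊖-homo zero    zero    = sym (-‿inverseʳ 0#)
    ⊖-homo zero    (suc n) = sym (+-identityˡ _)
    ⊖-homo (suc m) zero    = sym (trans (+-congˡ -0#≈0#) (+-identityʳ _))
    ⊖-homo (suc m) (suc n) =
      trans (reflexive (≡.cong ⟦_⟧ℤ (ℤₚ.[1+m]⊖[1+n]≡m⊖n m n))) (trans (⊖-homo m n) (sym (trans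
        (+-cong (Mult.1+× m 1#) (-‿cong (Mult.1+× n 1#))) (1+x-[1+y]≈x-y _ _))))

    ◃-homo : ∀ s n → ⟦ s ◃ n ⟧ℤ ≈ sign-value s * (n Mult.× 1#)
    ◃-homo s      zero    = sym (zeroʳ _)
    ◃-homo Sign.+ (suc n) = sym (*-identityˡ _)
    ◃-homo Sign.- (suc n) = sym (-1*x≈-x _)

    sign-value-homo : ∀ s t → sign-value (s Sign.* t) ≈ sign-value s * sign-value t
    sign-value-homo Sign.+ t      = sym (*-identityˡ _)
    sign-value-homo Sign.- Sign.+ = sym (*-identityʳ _)
    sign-value-homo Sign.- Sign.- = sym (trans (-1*x≈-x (- 1#)) (-‿involutive 1#))

    sign-magnitude : ∀ i → ⟦ i ⟧ℤ ≈ sign-value (sign i) * (∣ i ∣ Mult.× 1#)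
    sign-magnitude i = trans (reflexive (≡.cong ⟦_⟧ℤ (≡.sym (ℤₚ.◃-inverse i)))) (◃-homo (sign i) ∣ i ∣)

    +-homo : ∀ i j → ⟦ i ℤ.+ j ⟧ℤ ≈ ⟦ i ⟧ℤ + ⟦ j ⟧ℤ
    +-homo -[1+ m ] -[1+ n ] = begin
      - (suc (suc (m ℕ.+ n)) Mult.× 1#)            ≡⟨ ≡.cong (λ k → - (k Mult.× 1#)) (ℕₚ.+-suc (suc m) n) ⟨
      - ((suc m ℕ.+ suc n) Mult.× 1#)              ≈⟨ -‿cong (Mult.×-homo-+ 1# (suc m) (suc n)) ⟩
      - (suc m Mult.× 1# + suc n Mult.× 1#)        ≈⟨ -‿+-comm _ _ ⟨
      - (suc m Mult.× 1#) + - (suc n Mult.× 1#)    ∎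
    +-homo -[1+ m ] (+ n)    = trans (⊖-homo n (suc m)) (+-comm _ _)
    +-homo (+ m)    -[1+ n ] = ⊖-homo m (suc n)
    +-homo (+ m)    (+ n)    = Mult.×-homo-+ 1# m n

    *-homo : ∀ i j → ⟦ i ℤ.* j ⟧ℤ ≈ ⟦ i ⟧ℤ * ⟦ j ⟧ℤ
    *-homo i j = begin
      ⟦ i ℤ.* j ⟧ℤ
        ≈⟨ ◃-homo (sign i Sign.* sign j) (∣ i ∣ ℕ.* ∣ j ∣) ⟩
      sign-value (sign i Sign.* sign j) * ((∣ i ∣ ℕ.* ∣ j ∣) Mult.× 1#)
        ≈⟨ *-cong (sign-value-homo (sign i) (sign j)) (Mult.×1-homo-* ∣ i ∣ ∣ j ∣) ⟩
      (sign-value (sign i) * sign-value (sign j)) * ((∣ i ∣ Mult.× 1#) * (∣ j ∣ Mult.× 1#))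
        ≈⟨ interchange _ _ _ _ ⟩
      (sign-value (sign i) * (∣ i ∣ Mult.× 1#)) * (sign-value (sign j) * (∣ j ∣ Mult.× 1#))
        ≈⟨ *-cong (sign-magnitude i) (sign-magnitude j) ⟨
      ⟦ i ⟧ℤ * ⟦ j ⟧ℤ ∎

    neg-homo : ∀ i → ⟦ ℤ.- i ⟧ℤ ≈ - ⟦ i ⟧ℤ
    neg-homo -[1+ n ]  = sym (-‿involutive _)
    neg-homo (+ zero)  = sym -0#≈0#
    neg-homo (+ suc n) = refl

    ℤ-homomorphism : ℤ.+-*-rawRing -Raw-AlmostCommutative⟶ fromCommutativeRing R
    ℤ-homomorphism = record
      { ⟦_⟧ = ⟦_⟧ℤ ; +-homo = +-homo ; *-homo = *-homo ; -‿homo = neg-homo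
      ; 0-homo = refl ; 1-homo = refl }

  open Algebra.Solver.Ring ℤ.+-*-rawRing (fromCommutativeRing R) ℤ-homomorphism
    (λ i j → Maybe.map (reflexive ∘ ≡.cong ⟦_⟧ℤ) (dec⇒weaklyDec ℤ._≟_ i j)) public

  κ : ∀ {n} → ℕ → Polynomial n
  κ k = con (+ k)

module FilterLength {A : Set} where
  open ≡ using (refl; sym; trans; cong)

  private
    variable
      P Q : Pred A 0ℓ

  length-filter-split : (P? : Decidable P) (Q? : Decidable Q) (xs : List A) →
    length (filter P? xs) ≡ length (filter (P? ∩? Q?) xs) ℕ.+ length (filter (P? ∩? ∁? Q?) xs)
  length-filter-split P? Q? [] = refl
  length-filter-split P? Q? (x ∷ xs) with P? x | Q? x
  ... | yes _ | yes _ = cong suc (length-filter-split P? Q? xs)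
  ... | yes _ | no _  = trans (cong suc (length-filter-split P? Q? xs)) (sym (ℕₚ.+-suc _ _))
  ... | no _  | _     = length-filter-split P? Q? xs

  length-filter-mono : (P? : Decidable P) (Q? : Decidable Q) → P ⊆ Q → (xs : List A) →
    length (filter P? xs) ≤ length (filter Q? xs)
  length-filter-mono P? Q? P⊆Q [] = z≤n
  length-filter-mono P? Q? P⊆Q (x ∷ xs) with P? x | Q? x
  ... | yes _ | yes _  = s≤s (length-filter-mono P? Q? P⊆Q xs)
  ... | yes p | no ¬q  = ⊥-elim (¬q (P⊆Q p))
  ... | no _  | yes _  = ℕₚ.m≤n⇒m≤1+n (length-filter-mono P? Q? P⊆Q xs)
  ... | no _  | no _   = length-filter-mono P? Q? P⊆Q xs

  length-filter≢0⇒∃ : (P? : Decidable P) (xs : List A) → length (filter P? xs) ≢ 0 → ∃ P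
  length-filter≢0⇒∃ P? [] ≢0 = ⊥-elim (≢0 refl)
  length-filter≢0⇒∃ P? (x ∷ xs) ≢0 with P? x
  ... | yes p = x , p
  ... | no _  = length-filter≢0⇒∃ P? xs ≢0

length-filter-tabulate-unique : ∀ {B : Set} n (f : Fin n → B) {P : Pred B 0ℓ} (P? : Decidable P) (i : Fin n) →
  P (f i) → (∀ j → P (f j) → j ≡ i) → length (filter P? (tabulate f)) ≡ 1
length-filter-tabulate-unique (suc n) f P? i Pfi unique with P? (f Fin.zero)
... | yes Pf0 = ≡.cong (suc ∘ length) (filter-none P? (tabulate⁺ ¬P-tail))
  where
  ¬P-tail : ∀ j → ¬ _
  ¬P-tail j Pfj with ≡.trans (unique (Fin.suc j) Pfj) (≡.sym (unique Fin.zero Pf0))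
  ... | ()
length-filter-tabulate-unique (suc n) f P? Fin.zero    Pfi unique | no ¬Pf0 = ⊥-elim (¬Pf0 Pfi)
length-filter-tabulate-unique (suc n) f P? (Fin.suc i) Pfi unique | no ¬Pf0 =
  length-filter-tabulate-unique n (f ∘ Fin.suc) P? i Pfi (λ j Pfj → Finₚ.suc-injective (unique (Fin.suc j) Pfj))

module Counting (𝔽 : FiniteField) where
  open FiniteField 𝔽
  open ≡ using (refl; sym; trans; cong; subst)
  open FilterLength

  private
    variable
      P Q : Pred Carrier 0ℓ

  elt-idx : ∀ x → elt (idx x) ≡ x
  elt-idx = Inverse.strictlyInverseˡ enum

  idx-injective : ∀ {x y} → idx x ≡ idx y → x ≡ y
  idx-injective {x} {y} e = trans (sym (elt-idx x)) (trans (cong elt e) (elt-idx y))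

  count-split : (P? : Decidable P) (Q? : Decidable Q) → count P? ≡ count (P? ∩? Q?) ℕ.+ count (P? ∩? ∁? Q?)
  count-split P? Q? = length-filter-split (P? ∘ elt) (Q? ∘ elt) (allFin q)

  count-mono : (P? : Decidable P) (Q? : Decidable Q) → P ⊆ Q → count P? ≤ count Q?
  count-mono P? Q? P⊆Q = length-filter-mono (P? ∘ elt) (Q? ∘ elt) P⊆Q (allFin q)

  count-cong : (P? : Decidable P) (Q? : Decidable Q) → P ⊆ Q → Q ⊆ P → count P? ≡ count Q?
  count-cong P? Q? P⊆Q Q⊆P = ℕₚ.≤-antisym (count-mono P? Q? P⊆Q) (count-mono Q? P? Q⊆P)

  count-none : (P? : Decidable P) → (∀ x → ¬ P x) → count P? ≡ 0
  count-none P? ¬P = cong length (filter-none (P? ∘ elt) (tabulate⁺ (¬P ∘ elt)))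

  count-all : (P? : Decidable P) → (∀ x → P x) → count P? ≡ q
  count-all P? allP = trans (cong length (filter-all (P? ∘ elt) (tabulate⁺ (allP ∘ elt)))) (length-tabulate _)

  count≢0⇒∃ : (P? : Decidable P) → count P? ≢ 0 → ∃ P
  count≢0⇒∃ P? ≢0 with length-filter≢0⇒∃ (P? ∘ elt) (allFin q) ≢0
  ... | i , p = elt i , p

  count>0⇒∃ : (P? : Decidable P) → 0 ℕ.< count P? → ∃ P
  count>0⇒∃ P? 0<#P = count≢0⇒∃ P? (λ #P≡0 → ℕₚ.<-irrefl (sym #P≡0) 0<#P)

  count-partition : ∀ {R S : Pred Carrier 0ℓ} (P? : Decidable P) (Q? : Decidable Q) (R? : Decidable R) (S? : Decidable S) →
    P ∩ Q ⊆ R → R ⊆ P ∩ Q → P ∩ ∁ Q ⊆ S → S ⊆ P ∩ ∁ Q → count P? ≡ count R? ℕ.+ count S?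
  count-partition P? Q? R? S? PQ⊆R R⊆PQ P¬Q⊆S S⊆P¬Q = trans (count-split P? Q?)
    (≡.cong₂ ℕ._+_ (count-cong (P? ∩? Q?) R? PQ⊆R R⊆PQ) (count-cong (P? ∩? ∁? Q?) S? P¬Q⊆S S⊆P¬Q))

  count-unique : (P? : Decidable P) (a : Carrier) → P a → (∀ x → P x → x ≡ a) → count P? ≡ 1
  count-unique {P} P? a Pa unique = length-filter-tabulate-unique q (λ i → i) (P? ∘ elt) (idx a)
    (subst P (sym (elt-idx a)) Pa)
    (λ i Pi → trans (sym (Inverse.strictlyInverseʳ enum i)) (cong idx (unique (elt i) Pi)))

  count-remove : (P? : Decidable P) {a : Carrier} → P a → count P? ≡ suc (count (P? ∩? ∁? (_≟ a)))
  count-remove P? {a} Pa =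
    trans (count-split P? (_≟ a)) (cong (ℕ._+ count (P? ∩? ∁? (_≟ a))) (count-unique (P? ∩? (_≟ a)) a (Pa , refl) (λ _ → proj₂)))

  count-injective : ∀ n (P? : Decidable P) (Q? : Decidable Q) (f : Carrier → Carrier) → count P? ≡ n →
    (∀ {x} → P x → Q (f x)) → (∀ {x y} → P x → P y → f x ≡ f y → x ≡ y) → n ≤ count Q?
  count-injective zero    P? Q? f _ _ _ = z≤n
  count-injective (suc n) P? Q? f #P≡1+n f∈Q f-inj with count≢0⇒∃ P? (λ #P≡0 → ℕₚ.0≢1+n (trans (sym #P≡0) #P≡1+n))
  ... | x , Px = subst (suc n ≤_) (sym (count-remove Q? (f∈Q Px)))
    (s≤s (count-injective n (P? ∩? ∁? (_≟ x)) (Q? ∩? ∁? (_≟ f x)) f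
      (ℕₚ.suc-injective (trans (sym (count-remove P? Px)) #P≡1+n))
      (λ (Py , y≢x) → f∈Q Py , λ fy≡fx → y≢x (f-inj Py Px fy≡fx))
      (λ Py Pz → f-inj (proj₁ Py) (proj₁ Pz))))

  count≤1 : (P? : Decidable P) → (∀ {x y} → P x → P y → x ≡ y) → count P? ≤ 1
  count≤1 P? unique with count P? ℕ.≟ 0
  ... | yes #P≡0 = subst (_≤ 1) (sym #P≡0) z≤n
  ... | no #P≢0 with count≢0⇒∃ P? #P≢0
  ... | x , Px = subst (_≤ 1) (sym (count-remove P? Px))
    (s≤s (ℕₚ.≤-reflexive (count-none (P? ∩? ∁? (_≟ x)) (λ y (Py , y≢x) → y≢x (unique Py Px)))))

  count≤2 : (P? : Decidable P) → (∀ {x y z} → P x → P y → P z → x ≡ y ⊎ x ≡ z ⊎ y ≡ z) → count P? ≤ 2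
  count≤2 {P} P? two-classes with count P? ℕ.≟ 0
  ... | yes #P≡0 = subst (_≤ 2) (sym #P≡0) z≤n
  ... | no #P≢0 with count≢0⇒∃ P? #P≢0
  ... | x , Px = subst (_≤ 2) (sym (count-remove P? Px)) (s≤s (count≤1 (P? ∩? ∁? (_≟ x)) unique))
    where
    unique : ∀ {y z} → P y × y ≢ x → P z × z ≢ x → y ≡ z
    unique (Py , y≢x) (Pz , z≢x) with two-classes Px Py Pz
    ... | inj₁ x≡y        = ⊥-elim (y≢x (sym x≡y))
    ... | inj₂ (inj₁ x≡z) = ⊥-elim (z≢x (sym x≡z))
    ... | inj₂ (inj₂ y≡z) = y≡z

  count≡2⇒distinct : (P? : Decidable P) → count P? ≡ 2 → Σ Carrier λ x → Σ Carrier λ y → P x × P y × x ≢ y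
  count≡2⇒distinct P? #P≡2 with count≢0⇒∃ P? (λ #P≡0 → ℕₚ.0≢1+n (trans (sym #P≡0) #P≡2))
  ... | x , Px
    with count≢0⇒∃ (P? ∩? ∁? (_≟ x)) (λ #≡0 → ℕₚ.0≢1+n (trans (sym #≡0) (ℕₚ.suc-injective (trans (sym (count-remove P? Px)) #P≡2))))
  ... | y , (Py , y≢x) = x , y , Px , Py , λ x≡y → y≢x (sym x≡y)

  -- For an involution σ, Lower σ selects one element of each orbit {x, σ x} by the enumeration order.
  Lower : (Carrier → Carrier) → Pred Carrier 0ℓ
  Lower σ x = idx x Fin.< idx (σ x)

  lower? : (σ : Carrier → Carrier) → Decidable (Lower σ)
  lower? σ x = idx x Fin.<? idx (σ x)

  module _ {σ : Carrier → Carrier} where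

    lower-flip : ∀ {x} → σ (σ x) ≡ x → Lower σ x → ¬ Lower σ (σ x)
    lower-flip {x} σσx≡x x<σx σx<x = Finₚ.<-asym x<σx (subst (λ z → idx (σ x) Fin.< idx z) σσx≡x σx<x)

    lower-unflip : ∀ {x} → σ (σ x) ≡ x → σ x ≢ x → ¬ Lower σ x → Lower σ (σ x)
    lower-unflip {x} σσx≡x σx≢x x≮σx = subst (λ z → idx (σ x) Fin.< idx z) (sym σσx≡x) σx<x
      where
      σx<x : idx (σ x) Fin.< idx x
      σx<x with Finₚ.<-cmp (idx x) (idx (σ x))
      ... | tri< x<σx _ _ = ⊥-elim (x≮σx x<σx)
      ... | tri≈ _ x≡σx _ = ⊥-elim (σx≢x (sym (idx-injective x≡σx)))
      ... | tri> _ _ σx<x = σx<x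

    count-involution : (P? : Decidable P) → (∀ {x} → P x → P (σ x)) → (∀ {x} → P x → σ (σ x) ≡ x) →
      (∀ {x} → P x → σ x ≢ x) → count P? ≡ 2 ℕ.* count (P? ∩? lower? σ)
    count-involution {P} P? σ∈P σσ≡id σ≢id = trans (count-split P? (lower? σ))
      (cong (count (P? ∩? lower? σ) ℕ.+_) (trans #upper≡#lower (sym (ℕₚ.+-identityʳ _))))
      where
      σ-injective : ∀ {x y} → P x → P y → σ x ≡ σ y → x ≡ y
      σ-injective Px Py σx≡σy = trans (sym (σσ≡id Px)) (trans (cong σ σx≡σy) (σσ≡id Py))
      #upper≡#lower : count (P? ∩? ∁? (lower? σ)) ≡ count (P? ∩? lower? σ)
      #upper≡#lower = ℕₚ.≤-antisym
        (count-injective _ (P? ∩? ∁? (lower? σ)) (P? ∩? lower? σ) σ refl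
          (λ (Px , x≮σx) → σ∈P Px , lower-unflip (σσ≡id Px) (σ≢id Px) x≮σx) (λ x y → σ-injective (proj₁ x) (proj₁ y)))
        (count-injective _ (P? ∩? lower? σ) (P? ∩? ∁? (lower? σ)) σ refl
          (λ (Px , x<σx) → σ∈P Px , lower-flip (σσ≡id Px) x<σx) (λ x y → σ-injective (proj₁ x) (proj₁ y)))

    representative : Carrier → Carrier
    representative x with lower? σ x
    ... | yes _ = x
    ... | no _  = σ x

    representative-lower : ∀ {x} → σ (σ x) ≡ x → σ x ≢ x → Lower σ (representative x)
    representative-lower {x} σσx≡x σx≢x with lower? σ x
    ... | yes x<σx = x<σx
    ... | no x≮σx  = lower-unflip σσx≡x σx≢x x≮σx

    representative-cases : ∀ x → representative x ≡ x ⊎ representative x ≡ σ x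
    representative-cases x with lower? σ x
    ... | yes _ = inj₁ refl
    ... | no _  = inj₂ refl

    representative-of-lower : ∀ {x} → Lower σ x → representative x ≡ x
    representative-of-lower {x} x<σx with lower? σ x
    ... | yes _    = refl
    ... | no x≮σx  = ⊥-elim (x≮σx x<σx)

    representative-of-upper : ∀ {x} → σ (σ x) ≡ x → Lower σ x → representative (σ x) ≡ x
    representative-of-upper {x} σσx≡x x<σx with lower? σ (σ x)
    ... | yes σx<σσx = ⊥-elim (lower-flip σσx≡x x<σx σx<σσx)
    ... | no _       = σσx≡x

module FieldLemmas (𝔽 : FiniteField) where
  open FiniteField 𝔽

  commutativeRing : CommutativeRing 0ℓ 0ℓ
  commutativeRing = record { isCommutativeRing = isCommutativeRing }

  open CommutativeRing commutativeRing public
    using (+-assoc; +-comm; *-comm; *-assoc; +-identityˡ; +-identityʳ; *-identityˡ; *-identityʳ;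
           -‿inverseʳ; -‿inverseˡ; zeroˡ; zeroʳ; ring)
  open import Algebra.Properties.Ring ring public using (-1*x≈-x; -‿involutive; -‿distribˡ-*; -0#≈0#)
  open IntegerCoefficientSolver commutativeRing public
  open ≡ using (refl; sym; trans; cong; cong₂; module ≡-Reasoning)
  open ≡-Reasoning

  2# 4# : Carrier
  2# = ⟦ ℤ.+ 2 ⟧ℤ
  4# = ⟦ ℤ.+ 4 ⟧ℤ

  1≢0 : 1# ≢ 0#
  1≢0 1≡0 = 0≢1 (sym 1≡0)

  ⁻¹-inverseˡ : ∀ {x} → x ≢ 0# → x ⁻¹ * x ≡ 1#
  ⁻¹-inverseˡ {x} x≢0 = trans (*-comm (x ⁻¹) x) (⁻¹-inverse x x≢0)

  *-cancelˡ : ∀ {a x y} → a ≢ 0# → a * x ≡ a * y → x ≡ y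
  *-cancelˡ {a} {x} {y} a≢0 ax≡ay = trans (unfold x) (trans (cong (a ⁻¹ *_) ax≡ay) (sym (unfold y)))
    where
    unfold : ∀ z → z ≡ a ⁻¹ * (a * z)
    unfold z = begin
      z               ≡⟨ sym (*-identityˡ z) ⟩
      1# * z          ≡⟨ cong (_* z) (sym (⁻¹-inverseˡ a≢0)) ⟩
      (a ⁻¹ * a) * z  ≡⟨ *-assoc _ _ _ ⟩
      a ⁻¹ * (a * z)  ∎

  x*y≡0⇒x≡0⊎y≡0 : ∀ {x y} → x * y ≡ 0# → x ≡ 0# ⊎ y ≡ 0#
  x*y≡0⇒x≡0⊎y≡0 {x} {y} xy≡0 with x ≟ 0#
  ... | yes x≡0 = inj₁ x≡0
  ... | no x≢0  = inj₂ (*-cancelˡ x≢0 (trans xy≡0 (sym (zeroʳ x))))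

  x*y≢0 : ∀ {x y} → x ≢ 0# → y ≢ 0# → x * y ≢ 0#
  x*y≢0 x≢0 y≢0 xy≡0 with x*y≡0⇒x≡0⊎y≡0 xy≡0
  ... | inj₁ x≡0 = x≢0 x≡0
  ... | inj₂ y≡0 = y≢0 y≡0

  x*x≢0 : ∀ {x} → x ≢ 0# → x * x ≢ 0#
  x*x≢0 x≢0 = x*y≢0 x≢0 x≢0

  +-cancelʳ : ∀ {a x y} → x + a ≡ y + a → x ≡ y
  +-cancelʳ {a} {x} {y} x+a≡y+a = begin
    x             ≡⟨ solve 2 (λ x a → x := (x :+ a) :- a) refl x a ⟩
    (x + a) - a   ≡⟨ cong (_- a) x+a≡y+a ⟩
    (y + a) - a   ≡⟨ solve 2 (λ y a → (y :+ a) :- a := y) refl y a ⟩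
    y             ∎

  x-y≡0⇒x≡y : ∀ {x y} → x - y ≡ 0# → x ≡ y
  x-y≡0⇒x≡y {x} {y} x-y≡0 = +-cancelʳ (trans (x-y≡0) (sym (-‿inverseʳ y)))

  -‿injective : ∀ {x y} → - x ≡ - y → x ≡ y
  -‿injective {x} {y} -x≡-y = trans (sym (-‿involutive x)) (trans (cong -_ -x≡-y) (-‿involutive y))

  -x≢0 : ∀ {x} → x ≢ 0# → - x ≢ 0#
  -x≢0 {x} x≢0 -x≡0 = x≢0 (trans (sym (-‿involutive x)) (trans (cong -_ -x≡0) -0#≈0#))

  x*x≡y*y⇒x≡±y : ∀ {x y} → x * x ≡ y * y → x ≡ y ⊎ x ≡ - y
  x*x≡y*y⇒x≡±y {x} {y} xx≡yy with x*y≡0⇒x≡0⊎y≡0 {x - y} {x + y} (begin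
    (x - y) * (x + y)   ≡⟨ solve 2 (λ x y → (x :- y) :* (x :+ y) := x :* x :- y :* y) refl x y ⟩
    x * x - y * y       ≡⟨ cong (_- y * y) xx≡yy ⟩
    y * y - y * y       ≡⟨ -‿inverseʳ (y * y) ⟩
    0#                  ∎)
  ... | inj₁ x-y≡0 = inj₁ (x-y≡0⇒x≡y x-y≡0)
  ... | inj₂ x+y≡0 = inj₂ (x-y≡0⇒x≡y (trans (cong (x +_) (-‿involutive y)) x+y≡0))

  ⁻¹-unique : ∀ {x y} → x * y ≡ 1# → y ≡ x ⁻¹
  ⁻¹-unique {x} {y} xy≡1 = *-cancelˡ x≢0 (trans xy≡1 (sym (⁻¹-inverse x x≢0)))
    where
    x≢0 : x ≢ 0#
    x≢0 refl = 1≢0 (trans (sym xy≡1) (zeroˡ y))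

  ⁻¹-≢0 : ∀ {x} → x ≢ 0# → x ⁻¹ ≢ 0#
  ⁻¹-≢0 {x} x≢0 x⁻¹≡0 = 1≢0 (trans (sym (⁻¹-inverse x x≢0)) (trans (cong (x *_) x⁻¹≡0) (zeroʳ x)))

  ⁻¹-involutive : ∀ {x} → x ≢ 0# → (x ⁻¹) ⁻¹ ≡ x
  ⁻¹-involutive x≢0 = sym (⁻¹-unique (⁻¹-inverseˡ x≢0))

  -‿⁻¹ : ∀ {x} → x ≢ 0# → (- x) ⁻¹ ≡ - (x ⁻¹)
  -‿⁻¹ {x} x≢0 = sym (⁻¹-unique (trans (solve 2 (λ x y → (:- x) :* (:- y) := x :* y) refl x (x ⁻¹)) (⁻¹-inverse x x≢0)))

  ⁻¹-distrib-* : ∀ {x y} → x ≢ 0# → y ≢ 0# → (x * y) ⁻¹ ≡ x ⁻¹ * y ⁻¹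
  ⁻¹-distrib-* {x} {y} x≢0 y≢0 = sym (⁻¹-unique (begin
    (x * y) * (x ⁻¹ * y ⁻¹)     ≡⟨ solve 4 (λ x y u v → (x :* y) :* (u :* v) := (x :* u) :* (y :* v)) refl x y (x ⁻¹) (y ⁻¹) ⟩
    (x * x ⁻¹) * (y * y ⁻¹)     ≡⟨ cong₂ _*_ (⁻¹-inverse x x≢0) (⁻¹-inverse y y≢0) ⟩
    1# * 1#                     ≡⟨ *-identityˡ 1# ⟩
    1#                          ∎))

  -- Lets the solver check an identity that only holds modulo a relation a = b.
  x≡y+c*0 : ∀ {x y a b} c → a ≡ b → x ≡ y + c * (a - b) → x ≡ y
  x≡y+c*0 {x} {y} {a} {b} c a≡b x≡y+c[a-b] = begin
    x                ≡⟨ x≡y+c[a-b] ⟩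
    y + c * (a - b)  ≡⟨ cong (λ z → y + c * (z - b)) a≡b ⟩
    y + c * (b - b)  ≡⟨ solve 3 (λ y c b → y :+ c :* (b :- b) := y) refl y c b ⟩
    y                ∎

  x≡y+c*0+d*0 : ∀ {x y a b a′ b′} c d → a ≡ b → a′ ≡ b′ → x ≡ y + (c * (a - b) + d * (a′ - b′)) → x ≡ y
  x≡y+c*0+d*0 {y = y} {b = b} {b′ = b′} c d a≡b a′≡b′ eq = trans eq (begin
    y + (c * (_ - b) + d * (_ - b′))    ≡⟨ cong₂ (λ z z′ → y + (c * (z - b) + d * (z′ - b′))) a≡b a′≡b′ ⟩
    y + (c * (b - b) + d * (b′ - b′))   ≡⟨ solve 5 (λ y c b d b′ → y :+ (c :* (b :- b) :+ d :* (b′ :- b′)) := y) refl y c b d b′ ⟩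
    y                                   ∎)

  -- Defs leaves 0 ⁻¹ unspecified; fixing it to 0 makes inversion a total involution.
  inv₀ : Carrier → Carrier
  inv₀ x with x ≟ 0#
  ... | yes _ = 0#
  ... | no _  = x ⁻¹

  inv₀≡⁻¹ : ∀ {x} → x ≢ 0# → inv₀ x ≡ x ⁻¹
  inv₀≡⁻¹ {x} x≢0 with x ≟ 0#
  ... | yes x≡0 = ⊥-elim (x≢0 x≡0)
  ... | no _    = refl

  inv₀-0# : inv₀ 0# ≡ 0#
  inv₀-0# with 0# ≟ 0#
  ... | yes _   = refl
  ... | no 0≢0  = ⊥-elim (0≢0 refl)

  inv₀-inverse : ∀ {x} → x ≢ 0# → x * inv₀ x ≡ 1#
  inv₀-inverse {x} x≢0 = trans (cong (x *_) (inv₀≡⁻¹ x≢0)) (⁻¹-inverse x x≢0)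

  inv₀≢0 : ∀ {x} → x ≢ 0# → inv₀ x ≢ 0#
  inv₀≢0 x≢0 inv₀x≡0 = ⁻¹-≢0 x≢0 (trans (sym (inv₀≡⁻¹ x≢0)) inv₀x≡0)

  inv₀-involutive : ∀ x → inv₀ (inv₀ x) ≡ x
  inv₀-involutive x with x ≟ 0#
  ... | yes x≡0 = trans inv₀-0# (sym x≡0)
  ... | no x≢0  = trans (inv₀≡⁻¹ (⁻¹-≢0 x≢0)) (⁻¹-involutive x≢0)

  inv₀-unique : ∀ {x y} → x * y ≡ 1# → y ≡ inv₀ x
  inv₀-unique {x} {y} xy≡1 = trans (⁻¹-unique xy≡1) (sym (inv₀≡⁻¹ x≢0))
    where
    x≢0 : x ≢ 0#
    x≢0 refl = 1≢0 (trans (sym xy≡1) (zeroˡ y))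

  inv₀-‿ : ∀ x → inv₀ (- x) ≡ - inv₀ x
  inv₀-‿ x with x ≟ 0#
  ... | yes refl = trans (cong inv₀ -0#≈0#) (trans inv₀-0# (sym -0#≈0#))
  ... | no x≢0   = trans (inv₀≡⁻¹ (-x≢0 x≢0)) (-‿⁻¹ x≢0)

  inv₀-1# : inv₀ 1# ≡ 1#
  inv₀-1# = sym (inv₀-unique (*-identityˡ 1#))

  x≡y*z⇒x*inv₀z≡y : ∀ {x y z} → z ≢ 0# → x ≡ y * z → x * inv₀ z ≡ y
  x≡y*z⇒x*inv₀z≡y {x} {y} {z} z≢0 x≡yz = begin
    x * inv₀ z        ≡⟨ cong (_* inv₀ z) x≡yz ⟩
    (y * z) * inv₀ z  ≡⟨ *-assoc y z _ ⟩
    y * (z * inv₀ z)  ≡⟨ cong (y *_) (inv₀-inverse z≢0) ⟩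
    y * 1#            ≡⟨ *-identityʳ y ⟩
    y                 ∎

  Residue : Pred Carrier 0ℓ
  Residue x = x ≢ 0# × IsSquare x

  residue? : Decidable Residue
  residue? = ∁? (_≟ 0#) ∩? isSquare?

  square-0# : IsSquare 0#
  square-0# = 0# , zeroˡ 0#

  square-1# : IsSquare 1#
  square-1# = 1# , *-identityˡ 1#

  nonsquare⇒≢0 : ∀ {x} → ¬ IsSquare x → x ≢ 0#
  nonsquare⇒≢0 ¬□x refl = ¬□x square-0#

  root≢0 : ∀ {x y} → x ≢ 0# → y * y ≡ x → y ≢ 0#
  root≢0 x≢0 yy≡x refl = x≢0 (trans (sym yy≡x) (zeroˡ 0#))

  *-square : ∀ {x y} → IsSquare x → IsSquare y → IsSquare (x * y)
  *-square {x} {y} (u , uu≡x) (v , vv≡y) = u * v , (begin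
    (u * v) * (u * v)   ≡⟨ solve 2 (λ u v → (u :* v) :* (u :* v) := (u :* u) :* (v :* v)) refl u v ⟩
    (u * u) * (v * v)   ≡⟨ cong₂ _*_ uu≡x vv≡y ⟩
    x * y               ∎)

  square-cancelˡ : ∀ {x y} → Residue x → IsSquare (x * y) → IsSquare y
  square-cancelˡ {x} {y} (x≢0 , u , uu≡x) (w , ww≡xy) = w * u ⁻¹ , (begin
    (w * u ⁻¹) * (w * u ⁻¹)         ≡⟨ solve 2 (λ w v → (w :* v) :* (w :* v) := (w :* w) :* (v :* v)) refl w (u ⁻¹) ⟩
    (w * w) * (u ⁻¹ * u ⁻¹)         ≡⟨ cong (_* (u ⁻¹ * u ⁻¹)) (trans ww≡xy (cong (_* y) (sym uu≡x))) ⟩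
    ((u * u) * y) * (u ⁻¹ * u ⁻¹)   ≡⟨ solve 3 (λ u y v → ((u :* u) :* y) :* (v :* v) := y :* ((u :* v) :* (u :* v))) refl u y (u ⁻¹) ⟩
    y * ((u * u ⁻¹) * (u * u ⁻¹))   ≡⟨ cong (λ t → y * (t * t)) (⁻¹-inverse u (root≢0 x≢0 uu≡x)) ⟩
    y * (1# * 1#)                   ≡⟨ solve 1 (λ y → y :* (κ 1 :* κ 1) := y) refl y ⟩
    y                               ∎)

  ⁻¹-square : ∀ {x} → Residue x → IsSquare (x ⁻¹)
  ⁻¹-square {x} (x≢0 , u , uu≡x) = u ⁻¹ , trans (sym (⁻¹-distrib-* u≢0 u≢0)) (cong _⁻¹ uu≡x)
    where
    u≢0 : u ≢ 0#
    u≢0 = root≢0 x≢0 uu≡x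

module QuadraticResidues (𝔽 : FiniteField) (q≡7 : FiniteField.q 𝔽 % 8 ≡ 7) where
  open FiniteField 𝔽
  open FieldLemmas 𝔽
  open Counting 𝔽
  open SevenModEight {q} q≡7
  open ≡ using (refl; sym; trans; cong; cong₂; subst; module ≡-Reasoning)
  open ≡-Reasoning

  -- If 2 = 0, then x ↦ x + 1 is a fixed-point-free involution and q would be even.
  2#≢0 : 2# ≢ 0#
  2#≢0 2≡0 = q≢2k (count (U? ∩? lower? (λ x → x + 1#)))
    (trans (sym (count-all U? _)) (count-involution {λ x → x + 1#} U? _ x+1+1≡x (λ _ → x+1≢x)))
    where
    x+1+1≡x : ∀ {x} → U x → (x + 1#) + 1# ≡ x
    x+1+1≡x {x} _ = begin
      (x + 1#) + 1#  ≡⟨ solve 1 (λ x → (x :+ κ 1) :+ κ 1 := x :+ κ 2) refl x ⟩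
      x + 2#         ≡⟨ cong (x +_) 2≡0 ⟩
      x + 0#         ≡⟨ +-identityʳ x ⟩
      x              ∎
    x+1≢x : ∀ {x} → x + 1# ≢ x
    x+1≢x {x} x+1≡x = 1≢0 (begin
      1#             ≡⟨ solve 2 (λ x y → y := (x :+ y) :- x) refl x 1# ⟩
      (x + 1#) - x   ≡⟨ cong (_- x) x+1≡x ⟩
      x - x          ≡⟨ -‿inverseʳ x ⟩
      0#             ∎)

  -x≢x : ∀ {x} → x ≢ 0# → - x ≢ x
  -x≢x {x} x≢0 -x≡x with x*y≡0⇒x≡0⊎y≡0 {2#} {x} (begin
    2# * x     ≡⟨ solve 1 (λ x → κ 2 :* x := x :+ x) refl x ⟩
    x + x      ≡⟨ cong (_+ x) (sym -x≡x) ⟩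
    - x + x    ≡⟨ -‿inverseˡ x ⟩
    0#         ∎)
  ... | inj₁ 2≡0 = 2#≢0 2≡0
  ... | inj₂ x≡0 = x≢0 x≡0

  private
    √ : Carrier → Carrier
    √ z with isSquare? z
    ... | yes (y , _) = y
    ... | no _        = z

    √-square : ∀ {z} → IsSquare z → √ z * √ z ≡ z
    √-square {z} □z with isSquare? z
    ... | yes (y , yy≡z) = yy≡z
    ... | no ¬□z         = ⊥-elim (¬□z □z)

    #nonzero : q ≡ suc (count (∁? (_≟ 0#)))
    #nonzero = trans (sym (count-all U? _)) (trans (count-remove U? {0#} _)
      (cong suc (count-cong (U? ∩? ∁? (_≟ 0#)) (∁? (_≟ 0#)) proj₂ (λ x≢0 → _ , x≢0))))

    #nonzero≡2#residue : count (∁? (_≟ 0#)) ≡ 2 ℕ.* count residue?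
    #nonzero≡2#residue = trans (count-involution (∁? (_≟ 0#)) -x≢0 (λ _ → -‿involutive _) -x≢x)
      (cong (2 ℕ.*_) (ℕₚ.≤-antisym
        (count-injective _ (∁? (_≟ 0#) ∩? lower? (λ x → - x)) residue? (λ x → x * x) refl
          (λ (x≢0 , _) → x*x≢0 x≢0 , (_ , refl)) square-injective)
        (count-injective _ residue? (∁? (_≟ 0#) ∩? lower? (λ x → - x)) (λ z → representative (√ z)) refl
          (λ (z≢0 , □z) → rep≢0 z≢0 □z , representative-lower (-‿involutive _) (-x≢x (root≢0 z≢0 (√-square □z))))
          (λ (_ , □z) (_ , □w) e → trans (sym (rep²≡ □z)) (trans (cong₂ _*_ e e) (rep²≡ □w))))))
      where
      square-injective : ∀ {x y} → x ≢ 0# × Lower (λ x → - x) x → y ≢ 0# × Lower (λ x → - x) y → x * x ≡ y * y → x ≡ y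
      square-injective (_ , x<-x) (_ , y<-y) xx≡yy with x*x≡y*y⇒x≡±y xx≡yy
      ... | inj₁ x≡y  = x≡y
      ... | inj₂ refl = ⊥-elim (lower-flip {λ x → - x} (-‿involutive _) y<-y x<-x)
      rep²≡ : ∀ {z} → IsSquare z → representative (√ z) * representative (√ z) ≡ z
      rep²≡ {z} □z = [ (λ r≡y → trans (cong square r≡y) (√-square □z))
                     , (λ r≡-y → trans (cong square r≡-y) (trans (solve 1 (λ y → (:- y) :* (:- y) := y :* y) refl (√ z)) (√-square □z)))
                     ]′ (representative-cases {λ x → - x} (√ z))
        where
        square : Carrier → Carrier
        square t = t * t
      rep≢0 : ∀ {z} → z ≢ 0# → IsSquare z → representative (√ z) ≢ 0#
      rep≢0 z≢0 □z rep≡0 = z≢0 (trans (sym (rep²≡ □z)) (trans (cong (λ t → t * t) rep≡0) (zeroˡ 0#)))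

  q≡1+2#residue : q ≡ suc (2 ℕ.* count residue?)
  q≡1+2#residue = trans #nonzero (cong suc #nonzero≡2#residue)

  -1-nonsquare : ¬ IsSquare (- 1#)
  -1-nonsquare (i , ii≡-1) = q≢1+4k (count (residue? ∩? lower? (λ x → - x))) (trans q≡1+2#residue (cong (λ k → suc (2 ℕ.* k))
    (count-involution {λ x → - x} residue? -residue (λ _ → -‿involutive _) (λ (x≢0 , _) → -x≢x x≢0))))
    where
    -residue : ∀ {x} → Residue x → Residue (- x)
    -residue {x} (x≢0 , y , yy≡x) = -x≢0 x≢0 , i * y , (begin
      (i * y) * (i * y)   ≡⟨ solve 2 (λ i y → (i :* y) :* (i :* y) := (i :* i) :* (y :* y)) refl i y ⟩
      (i * i) * (y * y)   ≡⟨ cong₂ _*_ ii≡-1 yy≡x ⟩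
      - 1# * x            ≡⟨ -1*x≈-x x ⟩
      - x                 ∎)

  #nonresidue≡#residue : count (∁? isSquare?) ≡ count residue?
  #nonresidue≡#residue = ℕₚ.+-cancelˡ-≡ (count residue?) _ _ (begin
    count residue? ℕ.+ count (∁? isSquare?)   ≡⟨ cong (count residue? ℕ.+_) (count-cong (∁? isSquare?) (∁? (_≟ 0#) ∩? ∁? isSquare?)
                                                   (λ ¬□x → nonsquare⇒≢0 ¬□x , ¬□x) proj₂) ⟩
    count (∁? (_≟ 0#) ∩? isSquare?) ℕ.+ count (∁? (_≟ 0#) ∩? ∁? isSquare?) ≡⟨ count-split (∁? (_≟ 0#)) isSquare? ⟨
    count (∁? (_≟ 0#))                        ≡⟨ #nonzero≡2#residue ⟩
    2 ℕ.* count residue?                      ≡⟨ cong (count residue? ℕ.+_) (ℕₚ.+-identityʳ _) ⟩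
    count residue? ℕ.+ count residue?         ∎)

  -- Otherwise z ↦ x · z would inject the residues and y into the non-squares, which are as many as the residues.
  nonsquare*nonsquare : ∀ {x y} → ¬ IsSquare x → ¬ IsSquare y → IsSquare (x * y)
  nonsquare*nonsquare {x} {y} ¬□x ¬□y with isSquare? (x * y)
  ... | yes □xy = □xy
  ... | no ¬□xy = ⊥-elim (ℕₚ.<-irrefl refl (subst (suc (count residue?) ≤_) #nonresidue≡#residue
        (count-injective _ (residue? ∪? (_≟ y)) (∁? isSquare?) (x *_) #residue∪y
          x*-nonsquare (λ _ _ → *-cancelˡ (nonsquare⇒≢0 ¬□x)))))
    where
    #residue∪y : count (residue? ∪? (_≟ y)) ≡ suc (count residue?)
    #residue∪y = trans (count-remove (residue? ∪? (_≟ y)) (inj₂ refl)) (cong suc (count-cong ((residue? ∪? (_≟ y)) ∩? ∁? (_≟ y)) residue?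
      (λ { (inj₁ r , _) → r ; (inj₂ z≡y , z≢y) → ⊥-elim (z≢y z≡y) })
      (λ { r@(_ , □z) → inj₁ r , λ { refl → ¬□y □z } })))
    x*-nonsquare : ∀ {z} → Residue z ⊎ z ≡ y → ¬ IsSquare (x * z)
    x*-nonsquare (inj₁ (z≢0 , □z)) □xz = ¬□x (square-cancelˡ (z≢0 , □z) (subst IsSquare (*-comm x _) □xz))
    x*-nonsquare (inj₂ refl)        = ¬□xy

  residue*nonsquare : ∀ {x y} → Residue x → ¬ IsSquare y → ¬ IsSquare (x * y)
  residue*nonsquare x-res ¬□y □xy = ¬□y (square-cancelˡ x-res □xy)

  -residue-nonsquare : ∀ {x} → Residue x → ¬ IsSquare (- x)
  -residue-nonsquare {x} x-res □-x = -1-nonsquare (square-cancelˡ x-res (subst IsSquare (sym x*-1≡-x) □-x))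
    where
    x*-1≡-x : x * - 1# ≡ - x
    x*-1≡-x = solve 1 (λ x → x :* (:- κ 1) := :- x) refl x

  -nonsquare-square : ∀ {x} → ¬ IsSquare x → IsSquare (- x)
  -nonsquare-square {x} ¬□x = subst IsSquare (-1*x≈-x x) (nonsquare*nonsquare -1-nonsquare ¬□x)

module TwoIsASquare (𝔽 : FiniteField) (q≡7 : FiniteField.q 𝔽 % 8 ≡ 7) where
  open FiniteField 𝔽
  open FieldLemmas 𝔽
  open Counting 𝔽
  open QuadraticResidues 𝔽 q≡7
  open SevenModEight {q} q≡7
  open ≡ using (refl; sym; trans; cong; cong₂; subst; module ≡-Reasoning)
  open ≡-Reasoning

  neg^ inv^ : Bool → Carrier → Carrier
  neg^ false x = x
  neg^ true  x = - x
  inv^ false x = x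
  inv^ true  x = inv₀ x

  klein : Bool → Bool → Carrier → Carrier
  klein s i x = neg^ s (inv^ i x)

  klein-∘ : ∀ s i s′ i′ x → klein s i (klein s′ i′ x) ≡ klein (s xor s′) (i xor i′) x
  klein-∘ s i s′ i′ x =
    trans (cong (neg^ s) (inv^-neg^ i s′ _)) (trans (neg^-∘ s s′ _) (cong (neg^ (s xor s′)) (inv^-∘ i i′ x)))
    where
    neg^-∘ : ∀ s s′ x → neg^ s (neg^ s′ x) ≡ neg^ (s xor s′) x
    neg^-∘ false s′    x = refl
    neg^-∘ true  false x = refl
    neg^-∘ true  true  x = -‿involutive x
    inv^-∘ : ∀ i i′ x → inv^ i (inv^ i′ x) ≡ inv^ (i xor i′) x
    inv^-∘ false i′    x = refl
    inv^-∘ true  false x = refl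
    inv^-∘ true  true  x = inv₀-involutive x
    inv^-neg^ : ∀ i s x → inv^ i (neg^ s x) ≡ neg^ s (inv^ i x)
    inv^-neg^ false s     x = refl
    inv^-neg^ true  false x = refl
    inv^-neg^ true  true  x = inv₀-‿ x

  _∼_ : Carrier → Carrier → Set
  x ∼ y = ∃₂ λ s i → y ≡ klein s i x

  ∼-trans : ∀ {x y z} → x ∼ y → y ∼ z → x ∼ z
  ∼-trans {x} (s , i , y≡) (s′ , i′ , z≡) = s′ xor s , i′ xor i , trans z≡ (trans (cong (klein s′ i′) y≡) (klein-∘ s′ i′ s i x))

  Generic : Pred Carrier 0ℓ
  Generic t = t ≢ 0# × t ≢ 1# × t ≢ - 1#

  1+t≢0 : ∀ {t} → Generic t → 1# + t ≢ 0#
  1+t≢0 {t} (_ , _ , t≢-1) 1+t≡0 = t≢-1 (begin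
    t                 ≡⟨ solve 1 (λ t → t := (κ 1 :+ t) :- κ 1) refl t ⟩
    (1# + t) - 1#     ≡⟨ cong (_- 1#) 1+t≡0 ⟩
    0# - 1#           ≡⟨ +-identityˡ _ ⟩
    - 1#              ∎)

  1-t≢0 : ∀ {t} → Generic t → 1# - t ≢ 0#
  1-t≢0 (_ , t≢1 , _) 1-t≡0 = t≢1 (sym (x-y≡0⇒x≡y 1-t≡0))

  generic-inv₀ : ∀ {t} → Generic t → Generic (inv₀ t)
  generic-inv₀ {t} (t≢0 , t≢1 , t≢-1) =
    inv₀≢0 t≢0 , (λ e → t≢1 (inv₀-cancel e inv₀-1#)) , (λ e → t≢-1 (inv₀-cancel e inv₀-[-1#]))
    where
    inv₀-[-1#] : inv₀ (- 1#) ≡ - 1#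
    inv₀-[-1#] = trans (inv₀-‿ 1#) (cong -_ inv₀-1#)
    inv₀-cancel : ∀ {y} → inv₀ t ≡ y → inv₀ y ≡ y → t ≡ y
    inv₀-cancel e fixed = trans (sym (inv₀-involutive t)) (trans (cong inv₀ e) fixed)

  cayley : Carrier → Carrier
  cayley t = (1# - t) * inv₀ (1# + t)

  cayley-defining : ∀ {t} → Generic t → cayley t * (1# + t) ≡ 1# - t
  cayley-defining {t} gt = begin
    ((1# - t) * inv₀ (1# + t)) * (1# + t)  ≡⟨ solve 3 (λ a v b → (a :* v) :* b := a :* (b :* v)) refl (1# - t) (inv₀ (1# + t)) (1# + t) ⟩
    (1# - t) * ((1# + t) * inv₀ (1# + t))  ≡⟨ cong ((1# - t) *_) (inv₀-inverse (1+t≢0 gt)) ⟩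
    (1# - t) * 1#                          ≡⟨ *-identityʳ _ ⟩
    1# - t                                 ∎

  cayley-generic : ∀ {t} → Generic t → Generic (cayley t)
  cayley-generic {t} gt@(t≢0 , _ , _) = c≢0 , c≢1 , c≢-1
    where
    c[1+t] : cayley t * (1# + t) ≡ 1# - t
    c[1+t] = cayley-defining gt
    c≢0 : cayley t ≢ 0#
    c≢0 c≡0 = 1-t≢0 gt (trans (sym c[1+t]) (trans (cong (_* (1# + t)) c≡0) (zeroˡ _)))
    c≢1 : cayley t ≢ 1#
    c≢1 c≡1 with x*y≡0⇒x≡0⊎y≡0 {2#} {t} (begin
      2# * t                          ≡⟨ solve 1 (λ t → κ 2 :* t := (κ 1 :+ t) :- (κ 1 :- t)) refl t ⟩
      (1# + t) - (1# - t)             ≡⟨ cong (λ c → (1# + t) - c) (sym c[1+t]) ⟩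
      (1# + t) - cayley t * (1# + t)  ≡⟨ cong (λ c → (1# + t) - c * (1# + t)) c≡1 ⟩
      (1# + t) - 1# * (1# + t)        ≡⟨ solve 1 (λ t → (κ 1 :+ t) :- κ 1 :* (κ 1 :+ t) := κ 0) refl t ⟩
      0#                              ∎)
    ... | inj₁ 2≡0 = 2#≢0 2≡0
    ... | inj₂ t≡0 = t≢0 t≡0
    c≢-1 : cayley t ≢ - 1#
    c≢-1 c≡-1 = 2#≢0 (begin
      2#                              ≡⟨ solve 1 (λ t → κ 2 := (κ 1 :- t) :+ (κ 1 :+ t)) refl t ⟩
      (1# - t) + (1# + t)             ≡⟨ cong (_+ (1# + t)) (sym c[1+t]) ⟩
      cayley t * (1# + t) + (1# + t)  ≡⟨ cong (λ c → c * (1# + t) + (1# + t)) c≡-1 ⟩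
      - 1# * (1# + t) + (1# + t)      ≡⟨ solve 1 (λ t → (:- κ 1) :* (κ 1 :+ t) :+ (κ 1 :+ t) := κ 0) refl t ⟩
      0#                              ∎)

  cayley-‿ : ∀ {t} → Generic t → cayley (- t) ≡ inv₀ (cayley t)
  cayley-‿ {t} gt = inv₀-unique (begin
    ((1# - t) * v) * ((1# - - t) * u)   ≡⟨ cong (λ z → ((1# - t) * v) * ((1# + z) * u)) (-‿involutive t) ⟩
    ((1# - t) * v) * ((1# + t) * u)     ≡⟨ solve 4 (λ a v b u → (a :* v) :* (b :* u) := (a :* u) :* (b :* v)) refl (1# - t) v (1# + t) u ⟩
    ((1# - t) * u) * ((1# + t) * v)     ≡⟨ cong₂ _*_ (inv₀-inverse (1-t≢0 gt)) (inv₀-inverse (1+t≢0 gt)) ⟩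
    1# * 1#                             ≡⟨ *-identityˡ 1# ⟩
    1#                                  ∎)
    where
    v u : Carrier
    v = inv₀ (1# + t)
    u = inv₀ (1# + - t)

  -- Both are polynomial identities modulo t · t⁻¹ = 1 and (1 + t) · (1 + t)⁻¹ = 1.
  cayley-inv₀ : ∀ {t} → Generic t → cayley (inv₀ t) ≡ - cayley t
  cayley-inv₀ {t} gt@(t≢0 , _ , _) = x≡y*z⇒x*inv₀z≡y (1+t≢0 (generic-inv₀ gt)) (sym
    (x≡y+c*0+d*0 (2# * v) (1# - w) (inv₀-inverse t≢0) (inv₀-inverse (1+t≢0 gt))
      (solve 3 (λ t v w → (:- ((κ 1 :- t) :* v)) :* (κ 1 :+ w)
                        := (κ 1 :- w) :+ ((κ 2 :* v) :* (t :* w :- κ 1) :+ (κ 1 :- w) :* ((κ 1 :+ t) :* v :- κ 1))) refl t v w)))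
    where
    v w : Carrier
    v = inv₀ (1# + t)
    w = inv₀ t

  cayley-involutive : ∀ {t} → Generic t → cayley (cayley t) ≡ t
  cayley-involutive {t} gt = x≡y*z⇒x*inv₀z≡y (1+t≢0 (cayley-generic gt)) (sym
    (x≡y+c*0 (1# - t) (inv₀-inverse (1+t≢0 gt))
      (solve 2 (λ t v → t :* (κ 1 :+ (κ 1 :- t) :* v) := (κ 1 :- (κ 1 :- t) :* v) :+ (κ 1 :- t) :* ((κ 1 :+ t) :* v :- κ 1)) refl t v)))
    where
    v : Carrier
    v = inv₀ (1# + t)

  cayley-klein : ∀ s i {t} → Generic t → cayley (klein s i t) ≡ klein i s (cayley t)
  cayley-klein false false gt = refl
  cayley-klein true  false gt = cayley-‿ gt
  cayley-klein false true  gt = cayley-inv₀ gt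
  cayley-klein true  true  {t} gt =
    trans (cayley-‿ (generic-inv₀ gt)) (trans (cong inv₀ (cayley-inv₀ gt)) (inv₀-‿ (cayley t)))

  squarePart : Carrier → Carrier
  squarePart u with isSquare? u
  ... | yes _ = u
  ... | no _  = - u

  ∼-squarePart : ∀ u → u ∼ squarePart u
  ∼-squarePart u with isSquare? u
  ... | yes _ = false , false , refl
  ... | no _  = true , false , refl

  Residue≢1 : Pred Carrier 0ℓ
  Residue≢1 = Residue ∩ ∁ (_≡ 1#)

  residue≢1? : Decidable Residue≢1
  residue≢1? = residue? ∩? ∁? (_≟ 1#)

  residue≢1⇒generic : ∀ {x} → Residue≢1 x → Generic x
  residue≢1⇒generic ((x≢0 , □x) , x≢1) = x≢0 , x≢1 , λ { refl → -1-nonsquare □x }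

  squarePart-residue≢1 : ∀ {u} → Generic u → Residue≢1 (squarePart u)
  squarePart-residue≢1 {u} (u≢0 , u≢1 , u≢-1) with isSquare? u
  ... | yes □u  = (u≢0 , □u) , u≢1
  ... | no ¬□u  = (-x≢0 u≢0 , -nonsquare-square ¬□u) , λ -u≡1 → u≢-1 (trans (sym (-‿involutive u)) (cong -_ -u≡1))

  inv₀-residue≢1 : ∀ {x} → Residue≢1 x → Residue≢1 (inv₀ x)
  inv₀-residue≢1 {x} r@((x≢0 , _) , x≢1) = (inv₀≢0 x≢0 , subst IsSquare (sym (inv₀≡⁻¹ x≢0)) (⁻¹-square (proj₁ r))) ,
    λ inv₀x≡1 → x≢1 (trans (sym (inv₀-involutive x)) (trans (cong inv₀ inv₀x≡1) inv₀-1#))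

  inv₀-fixedPointFree : ∀ {x} → Residue≢1 x → inv₀ x ≢ x
  inv₀-fixedPointFree {x} r@((x≢0 , □x) , x≢1) inv₀x≡x
    with x*x≡y*y⇒x≡±y (trans (cong (x *_) (sym inv₀x≡x)) (trans (inv₀-inverse x≢0) (sym (*-identityˡ 1#))))
  ... | inj₁ x≡1  = x≢1 x≡1
  ... | inj₂ refl = -1-nonsquare □x

  Chosen : Pred Carrier 0ℓ
  Chosen = Residue≢1 ∩ Lower inv₀

  chosen? : Decidable Chosen
  chosen? = residue≢1? ∩? lower? inv₀

  chosen-representative : ∀ {x} → Residue≢1 x → Chosen (representative {inv₀} x)
  chosen-representative {x} r with representative-cases {inv₀} x
  ... | inj₁ e = subst Residue≢1 (sym e) r , representative-lower (inv₀-involutive x) (inv₀-fixedPointFree r)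
  ... | inj₂ e = subst Residue≢1 (sym e) (inv₀-residue≢1 r) , representative-lower (inv₀-involutive x) (inv₀-fixedPointFree r)

  ∼-representative : ∀ x → x ∼ representative {inv₀} x
  ∼-representative x with representative-cases {inv₀} x
  ... | inj₁ e = false , false , e
  ... | inj₂ e = false , true , e

  -- Inside the orbit of a chosen t, squarePart lands in {t, t⁻¹} and representative then returns t.
  chosen-of-orbit : ∀ {t y} → Chosen t → t ∼ y → representative {inv₀} (squarePart y) ≡ t
  chosen-of-orbit {t} (((t≢0 , □t) , _) , t<t⁻¹) (s , i , refl) = finish s i
    where
    □inv₀t : IsSquare (inv₀ t)
    □inv₀t = subst IsSquare (sym (inv₀≡⁻¹ t≢0)) (⁻¹-square (t≢0 , □t))
    squarePart-of-square : ∀ {u} → IsSquare u → squarePart u ≡ u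
    squarePart-of-square {u} □u with isSquare? u
    ... | yes _   = refl
    ... | no ¬□u  = ⊥-elim (¬□u □u)
    squarePart-of-negated-residue : ∀ {u} → Residue u → squarePart (- u) ≡ u
    squarePart-of-negated-residue {u} ru with isSquare? (- u)
    ... | yes □-u = ⊥-elim (-residue-nonsquare ru □-u)
    ... | no _    = -‿involutive u
    finish : ∀ s i → representative {inv₀} (squarePart (klein s i t)) ≡ t
    finish false false = trans (cong representative (squarePart-of-square □t)) (representative-of-lower t<t⁻¹)
    finish true  false = trans (cong representative (squarePart-of-negated-residue (t≢0 , □t))) (representative-of-lower t<t⁻¹)
    finish false true  = trans (cong representative (squarePart-of-square □inv₀t)) (representative-of-upper (inv₀-involutive t) t<t⁻¹)
    finish true  true  = trans (cong representative (squarePart-of-negated-residue (inv₀≢0 t≢0 , □inv₀t)))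
                               (representative-of-upper (inv₀-involutive t) t<t⁻¹)

  -- The Cayley transform c(t) = (1 - t)/(1 + t) maps the orbit {±t, ±t⁻¹} to that of c(t) (swapping the
  -- roles of negation and inversion), so it induces an involution τ on chosen orbit representatives.
  τ : Carrier → Carrier
  τ t = representative {inv₀} (squarePart (cayley t))

  τ-chosen : ∀ {t} → Chosen t → Chosen (τ t)
  τ-chosen (r , _) = chosen-representative (squarePart-residue≢1 (cayley-generic (residue≢1⇒generic r)))

  ∼-τ : ∀ t → cayley t ∼ τ t
  ∼-τ t = ∼-trans (∼-squarePart (cayley t)) (∼-representative (squarePart (cayley t)))

  τ-involutive : ∀ {t} → Chosen t → τ (τ t) ≡ t
  τ-involutive {t} ct@(r , _) with ∼-τ t
  ... | s , i , τt≡ = chosen-of-orbit ct (i , s , (begin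
    cayley (τ t)                      ≡⟨ cong cayley τt≡ ⟩
    cayley (klein s i (cayley t))     ≡⟨ cayley-klein s i (cayley-generic gt) ⟩
    klein i s (cayley (cayley t))     ≡⟨ cong (klein i s) (cayley-involutive gt) ⟩
    klein i s t                       ∎))
    where
    gt : Generic t
    gt = residue≢1⇒generic r

  -- A fixed point t = ±c(t)^{±1} forces 2 = (t ± 1)² or -1 = t², where c(t)(1 + t) = 1 - t.
  τ-fixedPointFree : ¬ IsSquare 2# → ∀ {t} → Chosen t → τ t ≢ t
  τ-fixedPointFree ¬□2 {t} (r , _) τt≡t with ∼-τ t
  ... | s , i , τt≡ = fixed s i (trans (sym τt≡t) τt≡)
    where
    gt : Generic t
    gt = residue≢1⇒generic r
    c : Carrier
    c = cayley t
    c[1+t] : c * (1# + t) ≡ 1# - t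
    c[1+t] = cayley-defining gt
    c≢0 : c ≢ 0#
    c≢0 = proj₁ (cayley-generic gt)
    fixed : ∀ s i → t ≡ klein s i c → ⊥
    fixed false false t≡c = ¬□2 (t + 1# , (begin
      (t + 1#) * (t + 1#)      ≡⟨ solve 1 (λ t → (t :+ κ 1) :* (t :+ κ 1) := t :* (κ 1 :+ t) :+ (κ 1 :+ t)) refl t ⟩
      t * (1# + t) + (1# + t)  ≡⟨ cong (λ a → a * (1# + t) + (1# + t)) t≡c ⟩
      c * (1# + t) + (1# + t)  ≡⟨ cong (_+ (1# + t)) c[1+t] ⟩
      (1# - t) + (1# + t)      ≡⟨ solve 1 (λ t → (κ 1 :- t) :+ (κ 1 :+ t) := κ 2) refl t ⟩
      2#                       ∎))
    fixed true false t≡-c = -1-nonsquare (t , (begin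
      t * t                    ≡⟨ solve 1 (λ t → t :* t := t :* (κ 1 :+ t) :- t) refl t ⟩
      t * (1# + t) - t         ≡⟨ cong (λ a → a * (1# + t) - t) t≡-c ⟩
      - c * (1# + t) - t       ≡⟨ cong (_- t) (sym (-‿distribˡ-* c (1# + t))) ⟩
      - (c * (1# + t)) - t     ≡⟨ cong (λ a → - a - t) c[1+t] ⟩
      - (1# - t) - t           ≡⟨ solve 1 (λ t → :- (κ 1 :- t) :- t := :- κ 1) refl t ⟩
      - 1#                     ∎))
    fixed false true t≡c⁻¹ = -1-nonsquare (t , (begin
      t * t                           ≡⟨ solve 1 (λ t → t :* t := :- (t :* (κ 1 :- t)) :+ t) refl t ⟩
      - (t * (1# - t)) + t            ≡⟨ cong (λ a → - (t * a) + t) (sym c[1+t]) ⟩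
      - (t * (c * (1# + t))) + t      ≡⟨ cong (λ a → - a + t) (sym (*-assoc t c (1# + t))) ⟩
      - ((t * c) * (1# + t)) + t      ≡⟨ cong (λ a → - (a * (1# + t)) + t) tc≡1 ⟩
      - (1# * (1# + t)) + t           ≡⟨ solve 1 (λ t → :- (κ 1 :* (κ 1 :+ t)) :+ t := :- κ 1) refl t ⟩
      - 1#                            ∎))
      where
      tc≡1 : t * c ≡ 1#
      tc≡1 = trans (cong (_* c) t≡c⁻¹) (trans (*-comm _ c) (inv₀-inverse c≢0))
    fixed true true t≡-c⁻¹ = ¬□2 (t - 1# , (begin
      (t - 1#) * (t - 1#)                 ≡⟨ solve 1 (λ t → (t :- κ 1) :* (t :- κ 1) := (:- t) :* (κ 1 :- t) :- t :+ κ 1) refl t ⟩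
      - t * (1# - t) - t + 1#             ≡⟨ cong (λ a → - t * a - t + 1#) (sym c[1+t]) ⟩
      - t * (c * (1# + t)) - t + 1#       ≡⟨ cong (λ a → a - t + 1#) (sym (*-assoc (- t) c (1# + t))) ⟩
      (- t * c) * (1# + t) - t + 1#       ≡⟨ cong (λ a → a * (1# + t) - t + 1#) -tc≡1 ⟩
      1# * (1# + t) - t + 1#              ≡⟨ solve 1 (λ t → κ 1 :* (κ 1 :+ t) :- t :+ κ 1 := κ 2) refl t ⟩
      2#                                  ∎))
      where
      -tc≡1 : - t * c ≡ 1#
      -tc≡1 = trans (cong (_* c) (trans (cong -_ t≡-c⁻¹) (-‿involutive _))) (trans (*-comm _ c) (inv₀-inverse c≢0))

  2-square : IsSquare 2#
  2-square with isSquare? 2#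
  ... | yes □2 = □2
  ... | no ¬□2 = ⊥-elim (q≢3+8k (count (chosen? ∩? lower? τ)) (begin
    q                                     ≡⟨ q≡1+2#residue ⟩
    suc (2 ℕ.* count residue?)            ≡⟨ cong (λ k → suc (2 ℕ.* k)) (count-remove residue? (1≢0 , square-1#)) ⟩
    suc (2 ℕ.* suc (count residue≢1?))     ≡⟨ cong (λ k → suc (2 ℕ.* suc k)) #residue≢1 ⟩
    suc (2 ℕ.* suc (2 ℕ.* count chosen?)) ≡⟨ cong (λ k → suc (2 ℕ.* suc (2 ℕ.* k))) #chosen ⟩
    suc (2 ℕ.* suc (2 ℕ.* (2 ℕ.* count (chosen? ∩? lower? τ)))) ∎))
    where
    #residue≢1 : count residue≢1? ≡ 2 ℕ.* count chosen?
    #residue≢1 = count-involution residue≢1? inv₀-residue≢1 (λ {x} _ → inv₀-involutive x) inv₀-fixedPointFree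
    #chosen : count chosen? ≡ 2 ℕ.* count (chosen? ∩? lower? τ)
    #chosen = count-involution chosen? τ-chosen τ-involutive (τ-fixedPointFree ¬□2)

module Differences (𝔽 : FiniteField) (q≡7 : FiniteField.q 𝔽 % 8 ≡ 7) where
  open FiniteField 𝔽
  open FieldLemmas 𝔽
  open QuadraticResidues 𝔽 q≡7
  open TwoIsASquare 𝔽 q≡7 using (2-square)
  open ≡ using (refl; sym; trans; cong; cong₂; subst; module ≡-Reasoning)
  open ≡-Reasoning

  η-residue : ∀ {x} → Residue x → η x ≡ ℤ.1ℤ
  η-residue {x} (x≢0 , □x) with x ≟ 0#
  ... | yes x≡0 = ⊥-elim (x≢0 x≡0)
  ... | no _ with isSquare? x
  ...   | yes _  = refl
  ...   | no ¬□x = ⊥-elim (¬□x □x)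

  η-nonsquare : ∀ {x} → ¬ IsSquare x → η x ≡ ℤ.-1ℤ
  η-nonsquare {x} ¬□x with x ≟ 0#
  ... | yes x≡0 = ⊥-elim (nonsquare⇒≢0 ¬□x x≡0)
  ... | no _ with isSquare? x
  ...   | yes □x = ⊥-elim (¬□x □x)
  ...   | no _   = refl

  η-0# : η 0# ≡ ℤ.0ℤ
  η-0# with 0# ≟ 0#
  ... | yes _   = refl
  ... | no 0≢0  = ⊥-elim (0≢0 refl)

  data Character (x : Carrier) : Set where
    zero      : x ≡ 0# → Character x
    residue   : Residue x → Character x
    nonsquare : ¬ IsSquare x → Character x

  character : ∀ x → Character x
  character x with x ≟ 0#
  ... | yes x≡0 = zero x≡0
  ... | no x≢0 with isSquare? x
  ...   | yes □x  = residue (x≢0 , □x)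
  ...   | no ¬□x  = nonsquare ¬□x

  η≡1⇒residue : ∀ {x} → η x ≡ ℤ.1ℤ → Residue x
  η≡1⇒residue {x} ηx≡1 with character x
  ... | zero refl     with () ← trans (sym η-0#) ηx≡1
  ... | residue rx    = rx
  ... | nonsquare ¬□x with () ← trans (sym (η-nonsquare ¬□x)) ηx≡1

  η≡-1⇒nonsquare : ∀ {x} → η x ≡ ℤ.-1ℤ → ¬ IsSquare x
  η≡-1⇒nonsquare {x} ηx≡-1 with character x
  ... | zero refl     with () ← trans (sym η-0#) ηx≡-1
  ... | residue rx    with () ← trans (sym (η-residue rx)) ηx≡-1
  ... | nonsquare ¬□x = ¬□x

  3#≢0 : 3# ≢ 0#
  3#≢0 3≡0 = -1-nonsquare (subst IsSquare (begin
    2#            ≡⟨ solve 0 (κ 2 := κ 3 :- κ 1) refl ⟩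
    3# - 1#       ≡⟨ cong (_- 1#) 3≡0 ⟩
    0# - 1#       ≡⟨ +-identityˡ _ ⟩
    - 1#          ∎) 2-square)

  ⅓ ⅔ : Carrier
  ⅓ = 3# ⁻¹
  ⅔ = 2# * ⅓

  1≡3*⅓ : 1# ≡ 3# * ⅓
  1≡3*⅓ = sym (⁻¹-inverse 3# 3#≢0)

  ⅔≢0 : ⅔ ≢ 0#
  ⅔≢0 = x*y≢0 2#≢0 (⁻¹-≢0 3#≢0)

  F-residue : ∀ {y} → Residue y → F y ≡ y * y * (1# + ⅓ * 1#)
  F-residue ry = cong (λ z → _ * _ * (1# + ⅓ * ι z)) (η-residue ry)

  F-nonsquare : ∀ {y} → ¬ IsSquare y → F y ≡ y * y * (1# + ⅓ * - 1#)
  F-nonsquare ¬□y = cong (λ z → _ * _ * (1# + ⅓ * ι z)) (η-nonsquare ¬□y)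

  F-0# : F 0# ≡ 0#
  F-0# = solve 1 (λ z → κ 0 :* κ 0 :* z := κ 0) refl (1# + ⅓ * ι (η 0#))

  Δ : Carrier → Carrier
  Δ x = F (x + 1#) - F x

  E00 E01 E10 E11 : Carrier → Carrier
  E00 x = 4# * x + 2#
  E01 x = - (x * x) + 2# * x + 1#
  E10 x = x * x + 4# * x + 2#
  E11 x = 2# * x + 1#

  -- The same polynomials as solver expressions, interpreted definitionally as E00, …, E11.
  E00ᵖ E01ᵖ E10ᵖ E11ᵖ : ∀ {n} → Polynomial n → Polynomial n
  E00ᵖ x = κ 4 :* x :+ κ 2
  E01ᵖ x = :- (x :* x) :+ κ 2 :* x :+ κ 1
  E10ᵖ x = x :* x :+ κ 4 :* x :+ κ 2
  E11ᵖ x = κ 2 :* x :+ κ 1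

  -- In each case the difference is a polynomial in x and ⅓ that reduces to ⅔ · E using 3 · ⅓ = 1.
  Δ-00 : ∀ {x} → Residue x → Residue (x + 1#) → Δ x ≡ ⅔ * E00 x
  Δ-00 {x} rx rx+1 = trans (cong₂ _-_ (F-residue rx+1) (F-residue rx)) (x≡y+c*0 (2# * x + 1#) 1≡3*⅓
    (solve 2 (λ x k → (x :+ κ 1) :* (x :+ κ 1) :* (κ 1 :+ k :* κ 1) :- x :* x :* (κ 1 :+ k :* κ 1)
                     := (κ 2 :* k) :* E00ᵖ x :+ (κ 2 :* x :+ κ 1) :* (κ 1 :- κ 3 :* k)) refl x ⅓))

  Δ-01 : ∀ {x} → Residue x → ¬ IsSquare (x + 1#) → Δ x ≡ ⅔ * E01 x
  Δ-01 {x} rx ¬□x+1 = trans (cong₂ _-_ (F-nonsquare ¬□x+1) (F-residue rx)) (x≡y+c*0 (2# * x + 1#) 1≡3*⅓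
    (solve 2 (λ x k → (x :+ κ 1) :* (x :+ κ 1) :* (κ 1 :+ k :* (:- κ 1)) :- x :* x :* (κ 1 :+ k :* κ 1)
                     := (κ 2 :* k) :* E01ᵖ x :+ (κ 2 :* x :+ κ 1) :* (κ 1 :- κ 3 :* k)) refl x ⅓))

  Δ-10 : ∀ {x} → ¬ IsSquare x → Residue (x + 1#) → Δ x ≡ ⅔ * E10 x
  Δ-10 {x} ¬□x rx+1 = trans (cong₂ _-_ (F-residue rx+1) (F-nonsquare ¬□x)) (x≡y+c*0 (2# * x + 1#) 1≡3*⅓
    (solve 2 (λ x k → (x :+ κ 1) :* (x :+ κ 1) :* (κ 1 :+ k :* κ 1) :- x :* x :* (κ 1 :+ k :* (:- κ 1))
                     := (κ 2 :* k) :* E10ᵖ x :+ (κ 2 :* x :+ κ 1) :* (κ 1 :- κ 3 :* k)) refl x ⅓))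

  Δ-11 : ∀ {x} → ¬ IsSquare x → ¬ IsSquare (x + 1#) → Δ x ≡ ⅔ * E11 x
  Δ-11 {x} ¬□x ¬□x+1 = trans (cong₂ _-_ (F-nonsquare ¬□x+1) (F-nonsquare ¬□x)) (x≡y+c*0 (2# * x + 1#) 1≡3*⅓
    (solve 2 (λ x k → (x :+ κ 1) :* (x :+ κ 1) :* (κ 1 :+ k :* (:- κ 1)) :- x :* x :* (κ 1 :+ k :* (:- κ 1))
                     := (κ 2 :* k) :* (κ 2 :* x :+ κ 1) :+ (κ 2 :* x :+ κ 1) :* (κ 1 :- κ 3 :* k)) refl x ⅓))

  Δ-0# : Δ 0# ≡ ⅔ * 2#
  Δ-0# = trans (cong₂ _-_ (F-residue r0+1) F-0#) (x≡y+c*0 1# 1≡3*⅓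
    (solve 1 (λ k → (κ 0 :+ κ 1) :* (κ 0 :+ κ 1) :* (κ 1 :+ k :* κ 1) :- κ 0
                   := (κ 2 :* k) :* κ 2 :+ κ 1 :* (κ 1 :- κ 3 :* k)) refl ⅓))
    where
    r0+1 : Residue (0# + 1#)
    r0+1 = subst Residue (sym (+-identityˡ 1#)) (1≢0 , square-1#)

  Δ-[-1#] : Δ (- 1#) ≡ ⅔ * - 1#
  Δ-[-1#] = trans (cong₂ _-_ (trans (cong F (-‿inverseˡ 1#)) F-0#) (F-nonsquare -1-nonsquare)) (x≡y+c*0 (- 1#) 1≡3*⅓
    (solve 1 (λ k → κ 0 :- (:- κ 1) :* (:- κ 1) :* (κ 1 :+ k :* (:- κ 1))
                   := (κ 2 :* k) :* (:- κ 1) :+ (:- κ 1) :* (κ 1 :- κ 3 :* k)) refl ⅓))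

module Collisions (𝔽 : FiniteField) (q≡7 : FiniteField.q 𝔽 % 8 ≡ 7) where
  open FiniteField 𝔽
  open FieldLemmas 𝔽
  open QuadraticResidues 𝔽 q≡7
  open TwoIsASquare 𝔽 q≡7 using (2-square)
  open Differences 𝔽 q≡7
  open ≡ using (refl; sym; trans; cong; subst)

  2-residue : Residue 2#
  2-residue = 2#≢0 , 2-square

  4-residue : Residue 4#
  4-residue = subst (λ z → z ≢ 0#) 2*2≡4 (x*x≢0 2#≢0) , 2# , 2*2≡4
    where
    2*2≡4 : 2# * 2# ≡ 4#
    2*2≡4 = solve 0 (κ 2 :* κ 2 := κ 4) refl

  x+1-nonsquare⇒x-1≢0 : ∀ {x} → ¬ IsSquare (x + 1#) → x - 1# ≢ 0#
  x+1-nonsquare⇒x-1≢0 ¬□x+1 x-1≡0 with x-y≡0⇒x≡y x-1≡0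
  ... | refl = ¬□x+1 2-square

  E00-injective : ∀ {x y} → E00 x ≡ E00 y → x ≡ y
  E00-injective = *-cancelˡ (proj₁ 4-residue) ∘ +-cancelʳ

  E11-injective : ∀ {x y} → E11 x ≡ E11 y → x ≡ y
  E11-injective = *-cancelˡ 2#≢0 ∘ +-cancelʳ

  [x-1]²≡2-E01 : ∀ x → (x - 1#) * (x - 1#) ≡ 2# - E01 x
  [x-1]²≡2-E01 = solve 1 (λ x → (x :- κ 1) :* (x :- κ 1) := κ 2 :- E01ᵖ x) refl

  [x+2]²≡E10+2 : ∀ x → (x + 2#) * (x + 2#) ≡ E10 x + 2#
  [x+2]²≡E10+2 = solve 1 (λ x → (x :+ κ 2) :* (x :+ κ 2) := E10ᵖ x :+ κ 2) refl

  square-collision : ∀ {x y z} c → (x + c) * (x + c) ≡ (y + c) * (y + c) → (x + c) * (x + c) ≡ (z + c) * (z + c) →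
    x ≡ y ⊎ x ≡ z ⊎ y ≡ z
  square-collision c xy xz with x*x≡y*y⇒x≡±y xy | x*x≡y*y⇒x≡±y xz
  ... | inj₁ x≡y  | _          = inj₁ (+-cancelʳ x≡y)
  ... | inj₂ _    | inj₁ x≡z   = inj₂ (inj₁ (+-cancelʳ x≡z))
  ... | inj₂ x≡-y | inj₂ x≡-z  = inj₂ (inj₂ (+-cancelʳ (-‿injective (trans (sym x≡-y) x≡-z))))

  E01-collision : ∀ {x y z} → E01 x ≡ E01 y → E01 x ≡ E01 z → x ≡ y ⊎ x ≡ z ⊎ y ≡ z
  E01-collision {x} {y} {z} xy xz = square-collision (- 1#)
    (trans ([x-1]²≡2-E01 x) (trans (cong (λ v → 2# - v) xy) (sym ([x-1]²≡2-E01 y))))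
    (trans ([x-1]²≡2-E01 x) (trans (cong (λ v → 2# - v) xz) (sym ([x-1]²≡2-E01 z))))

  E10-collision : ∀ {x y z} → E10 x ≡ E10 y → E10 x ≡ E10 z → x ≡ y ⊎ x ≡ z ⊎ y ≡ z
  E10-collision {x} {y} {z} xy xz = square-collision 2#
    (trans ([x+2]²≡E10+2 x) (trans (cong (_+ 2#) xy) (sym ([x+2]²≡E10+2 y))))
    (trans ([x+2]²≡E10+2 x) (trans (cong (_+ 2#) xz) (sym ([x+2]²≡E10+2 z))))

  E01-mirror : ∀ {x₁ x₂} → x₁ ≢ x₂ → E01 x₁ ≡ E01 x₂ → x₁ - 1# ≡ - (x₂ - 1#)
  E01-mirror {x₁} {x₂} x₁≢x₂ e
    with x*x≡y*y⇒x≡±y (trans ([x-1]²≡2-E01 x₁) (trans (cong (λ v → 2# - v) e) (sym ([x-1]²≡2-E01 x₂))))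
  ... | inj₁ same    = ⊥-elim (x₁≢x₂ (+-cancelʳ same))
  ... | inj₂ mirror  = mirror

  E10-mirror : ∀ {y₁ y₂} → y₁ ≢ y₂ → E10 y₁ ≡ E10 y₂ → y₁ + 2# ≡ - (y₂ + 2#)
  E10-mirror {y₁} {y₂} y₁≢y₂ e
    with x*x≡y*y⇒x≡±y (trans ([x+2]²≡E10+2 y₁) (trans (cong (_+ 2#) e) (sym ([x+2]²≡E10+2 y₂))))
  ... | inj₁ same    = ⊥-elim (y₁≢y₂ (+-cancelʳ same))
  ... | inj₂ mirror  = mirror

  E01≢E00 : ∀ {x y} → Residue y → E01 x ≢ E00 y
  E01≢E00 {x} {y} ry e = -1-nonsquare (square-cancelˡ 4y-residue (x - 1# , sym (x≡y+c*0 1# e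
    (solve 2 (λ x y → (κ 4 :* y) :* (:- κ 1) := (x :- κ 1) :* (x :- κ 1) :+ κ 1 :* (E01ᵖ x :- E00ᵖ y)) refl x y))))
    where
    4y-residue : Residue (4# * y)
    4y-residue = x*y≢0 (proj₁ 4-residue) (proj₁ ry) , *-square (proj₂ 4-residue) (proj₂ ry)

  E01≢2 : ∀ {x} → ¬ IsSquare (x + 1#) → E01 x ≢ 2#
  E01≢2 {x} ¬□x+1 e = x*x≢0 (x+1-nonsquare⇒x-1≢0 ¬□x+1) (x≡y+c*0 1# (sym e)
    (solve 1 (λ x → (x :- κ 1) :* (x :- κ 1) := κ 0 :+ κ 1 :* (κ 2 :- E01ᵖ x)) refl x))

  E01≢-1 : ∀ {x} → ¬ IsSquare (x + 1#) → E01 x ≢ - 1#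
  E01≢-1 {x} ¬□x+1 e = residue*nonsquare 2-residue ¬□x+1 (x , x≡y+c*0 1# (sym e)
    (solve 1 (λ x → x :* x := κ 2 :* (x :+ κ 1) :+ κ 1 :* ((:- κ 1) :- E01ᵖ x)) refl x))

  -- From E01 x = E10 y: (x - 1)² = -y (y + 4), so y + 4 is a square, and (x + y + 3)² = 2 (y + 4) (x + 1).
  E01≢E10 : ∀ {x y} → ¬ IsSquare (x + 1#) → ¬ IsSquare y → E01 x ≢ E10 y
  E01≢E10 {x} {y} ¬□x+1 ¬□y e = residue*nonsquare 2[y+4]-residue ¬□x+1 (x + y + 3# , x≡y+c*0 1# (sym e)
    (solve 2 (λ x y → (x :+ y :+ κ 3) :* (x :+ y :+ κ 3)
                    := (κ 2 :* (y :+ κ 4)) :* (x :+ κ 1) :+ κ 1 :* (E10ᵖ y :- E01ᵖ x)) refl x y))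
    where
    [x-1]²≡-y[y+4] : (x - 1#) * (x - 1#) ≡ - y * (y + 4#)
    [x-1]²≡-y[y+4] = x≡y+c*0 1# (sym e)
      (solve 2 (λ x y → (x :- κ 1) :* (x :- κ 1) := (:- y) :* (y :+ κ 4) :+ κ 1 :* (E10ᵖ y :- E01ᵖ x)) refl x y)
    y+4≢0 : y + 4# ≢ 0#
    y+4≢0 y+4≡0 = x*x≢0 (x+1-nonsquare⇒x-1≢0 ¬□x+1) (trans [x-1]²≡-y[y+4] (trans (cong (- y *_) y+4≡0) (zeroʳ _)))
    2[y+4]-residue : Residue (2# * (y + 4#))
    2[y+4]-residue = x*y≢0 2#≢0 y+4≢0 ,
      *-square 2-square (square-cancelˡ (-x≢0 (nonsquare⇒≢0 ¬□y) , -nonsquare-square ¬□y) (x - 1# , [x-1]²≡-y[y+4]))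

  E01-pair≢E11 : ∀ {x₁ x₂ z} → IsSquare x₁ → IsSquare x₂ → x₁ - 1# ≡ - (x₂ - 1#) → ¬ IsSquare z → E01 x₁ ≢ E11 z
  E01-pair≢E11 {x₁} {x₂} {z} □x₁ □x₂ mirror ¬□z e =
    ¬□z (square-cancelˡ 2-residue (subst IsSquare x₁x₂≡2z (*-square □x₁ □x₂)))
    where
    x₁x₂≡2z : x₁ * x₂ ≡ 2# * z
    x₁x₂≡2z = x≡y+c*0+d*0 1# x₁ e mirror
      (solve 3 (λ x₁ x₂ z → x₁ :* x₂ := κ 2 :* z :+ (κ 1 :* (E01ᵖ x₁ :- E11ᵖ z)
                                                  :+ x₁ :* ((x₁ :- κ 1) :- (:- (x₂ :- κ 1))))) refl x₁ x₂ z)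

  E10-pair≢E00 : ∀ {y₁ y₂ w} → ¬ IsSquare y₁ → ¬ IsSquare y₂ → y₁ + 2# ≡ - (y₂ + 2#) → Residue w → E10 y₁ ≢ E00 w
  E10-pair≢E00 {y₁} {y₂} {w} ¬□y₁ ¬□y₂ mirror rw e =
    -1-nonsquare (square-cancelˡ 4w-residue (subst IsSquare y₁y₂≡-4w (nonsquare*nonsquare ¬□y₁ ¬□y₂)))
    where
    4w-residue : Residue (4# * w)
    4w-residue = x*y≢0 (proj₁ 4-residue) (proj₁ rw) , *-square (proj₂ 4-residue) (proj₂ rw)
    y₁y₂≡-4w : y₁ * y₂ ≡ (4# * w) * - 1#
    y₁y₂≡-4w = x≡y+c*0+d*0 1# y₁ (sym e) mirror
      (solve 3 (λ y₁ y₂ w → y₁ :* y₂ := (κ 4 :* w) :* (:- κ 1) :+ (κ 1 :* (E00ᵖ w :- E10ᵖ y₁)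
                                                               :+ y₁ :* ((y₁ :+ κ 2) :- (:- (y₂ :+ κ 2))))) refl y₁ y₂ w)

  E10-pair≢2 : ∀ {y₁ y₂} → y₁ ≢ 0# → y₂ ≢ 0# → y₁ + 2# ≡ - (y₂ + 2#) → E10 y₁ ≢ 2#
  E10-pair≢2 {y₁} {y₂} y₁≢0 y₂≢0 mirror e = x*y≢0 y₁≢0 y₂≢0 (x≡y+c*0+d*0 1# y₁ (sym e) mirror
    (solve 2 (λ y₁ y₂ → y₁ :* y₂ := κ 0 :+ (κ 1 :* (κ 2 :- E10ᵖ y₁) :+ y₁ :* ((y₁ :+ κ 2) :- (:- (y₂ :+ κ 2))))) refl y₁ y₂))

  E10-pair≢-1 : ∀ {y₁ y₂} → y₁ + 1# ≢ 0# → y₂ + 1# ≢ 0# → y₁ + 2# ≡ - (y₂ + 2#) → E10 y₁ ≢ - 1#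
  E10-pair≢-1 {y₁} {y₂} y₁+1≢0 y₂+1≢0 mirror e = x*y≢0 y₁+1≢0 y₂+1≢0 (x≡y+c*0+d*0 1# (y₁ + 1#) (sym e) mirror
    (solve 2 (λ y₁ y₂ → (y₁ :+ κ 1) :* (y₂ :+ κ 1) := κ 0 :+ (κ 1 :* ((:- κ 1) :- E10ᵖ y₁)
                                                             :+ (y₁ :+ κ 1) :* ((y₁ :+ κ 2) :- (:- (y₂ :+ κ 2))))) refl y₁ y₂))

  E00≢2 : ∀ {w} → w ≢ 0# → E00 w ≢ 2#
  E00≢2 {w} w≢0 e = x*y≢0 (proj₁ 4-residue) w≢0 (x≡y+c*0 1# e
    (solve 1 (λ w → κ 4 :* w := κ 0 :+ κ 1 :* (E00ᵖ w :- κ 2)) refl w))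

  E11≢2 : ∀ {w} → ¬ IsSquare w → E11 w ≢ 2#
  E11≢2 {w} ¬□w e = residue*nonsquare 2-residue ¬□w (1# , sym (x≡y+c*0 1# e
    (solve 1 (λ w → κ 2 :* w := κ 1 :* κ 1 :+ κ 1 :* (E11ᵖ w :- κ 2)) refl w)))

  2#≢-1 : 2# ≢ - 1#
  2#≢-1 e = -1-nonsquare (subst IsSquare e 2-square)

  E10≢-1 : ∀ {y} → Residue (y + 1#) → E10 y ≢ - 1#
  E10≢-1 {y} (y+1≢0 , □y+1) e with x*y≡0⇒x≡0⊎y≡0 (x≡y+c*0 1# e
    (solve 1 (λ y → (y :+ κ 1) :* (y :+ κ 3) := κ 0 :+ κ 1 :* (E10ᵖ y :- (:- κ 1))) refl y))
  ... | inj₁ y+1≡0 = y+1≢0 y+1≡0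
  ... | inj₂ y+3≡0 = -1-nonsquare (square-cancelˡ 2-residue (subst IsSquare y+1≡-2 □y+1))
    where
    y+1≡-2 : y + 1# ≡ 2# * - 1#
    y+1≡-2 = x≡y+c*0 1# y+3≡0 (solve 1 (λ y → y :+ κ 1 := κ 2 :* (:- κ 1) :+ κ 1 :* ((y :+ κ 3) :- κ 0)) refl y)

  E11≢-1 : ∀ {w} → ¬ IsSquare (w + 1#) → E11 w ≢ - 1#
  E11≢-1 {w} ¬□w+1 e with x*y≡0⇒x≡0⊎y≡0 (x≡y+c*0 1# e
    (solve 1 (λ w → κ 2 :* (w :+ κ 1) := κ 0 :+ κ 1 :* (E11ᵖ w :- (:- κ 1))) refl w))
  ... | inj₁ 2≡0   = 2#≢0 2≡0
  ... | inj₂ w+1≡0 = ¬□w+1 (subst IsSquare (sym w+1≡0) square-0#)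

module ExclusionTable where
  open import Data.Nat using (_+_)
  open ≡ using (refl; sym; trans; subst)

  -- a_ij counts the solutions in C_ij, z0 and zm count the solutions 0 and -1.
  record Exclusions (a00 a01 a10 a11 z0 zm : ℕ) : Set where
    field
      a00≤1 : a00 ≤ 1
      a01≤2 : a01 ≤ 2
      a10≤2 : a10 ≤ 2
      a11≤1 : a11 ≤ 1
      z0≤1  : z0 ≤ 1
      zm≤1  : zm ≤ 1
      a01≥1⇒ : 1 ≤ a01 → a00 ≡ 0 × a10 ≡ 0 × z0 ≡ 0 × zm ≡ 0
      a01≡2⇒ : a01 ≡ 2 → a11 ≡ 0
      a10≡2⇒ : a10 ≡ 2 → a00 ≡ 0 × z0 ≡ 0 × zm ≡ 0
      z0≥1⇒  : 1 ≤ z0 → a00 ≡ 0 × a11 ≡ 0 × zm ≡ 0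
      zm≥1⇒  : 1 ≤ zm → a10 ≡ 0 × a11 ≡ 0

  private
    at-most-2 : ∀ {d} {A : Set} → d ≤ 2 → d ≤ 3 × (d ≡ 3 → A)
    at-most-2 d≤2 = ℕₚ.m≤n⇒m≤1+n d≤2 , λ { refl → ⊥-elim (ℕₚ.<-irrefl refl d≤2) }

    reorder : ∀ {x y z : ℕ} → x ≡ 1 × y ≡ 1 × z ≡ 1 → y ≡ 1 × z ≡ 1 × x ≡ 1
    reorder (x≡1 , y≡1 , z≡1) = y≡1 , z≡1 , x≡1

    three-bits : ∀ {x y z} → x ≤ 1 → y ≤ 1 → z ≤ 1 → x + (y + z) ≤ 3 × (x + (y + z) ≡ 3 → x ≡ 1 × y ≡ 1 × z ≡ 1)
    three-bits (s≤s z≤n) (s≤s z≤n) (s≤s z≤n) = ℕₚ.≤-refl , λ _ → refl , refl , refl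
    three-bits z≤n       y≤1       z≤1       = at-most-2 (ℕₚ.+-mono-≤ y≤1 z≤1)
    three-bits (s≤s z≤n) z≤n       z≤1       = at-most-2 (s≤s z≤1)
    three-bits (s≤s z≤n) (s≤s z≤n) z≤n       = at-most-2 (s≤s (s≤s z≤n))

  -- The summands are ordered so that each case split below makes the sum compute.
  total-bound : ∀ {a00 a01 a10 a11 z0 zm} → Exclusions a00 a01 a10 a11 z0 zm →
    let d = a01 + (z0 + (zm + (a10 + (a00 + a11)))) in
    d ≤ 3 × (d ≡ 3 → (a10 ≡ 2 × a11 ≡ 1) ⊎ (a00 ≡ 1 × a11 ≡ 1 × a10 ≡ 1))
  total-bound record { a01≤2 = s≤s z≤n ; a11≤1 = a11≤1 ; a01≥1⇒ = a01≥1⇒ } with a01≥1⇒ (s≤s z≤n)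
  ... | refl , refl , refl , refl = at-most-2 (s≤s a11≤1)
  total-bound record { a01≤2 = s≤s (s≤s z≤n) ; a01≥1⇒ = a01≥1⇒ ; a01≡2⇒ = a01≡2⇒ } with a01≥1⇒ (s≤s z≤n) | a01≡2⇒ refl
  ... | refl , refl , refl , refl | refl = at-most-2 ℕₚ.≤-refl
  total-bound record { a01≤2 = z≤n ; z0≤1 = s≤s z≤n ; a10≤2 = s≤s (s≤s z≤n) ; a10≡2⇒ = a10≡2⇒ } with a10≡2⇒ refl
  ... | _ , () , _
  total-bound record { a01≤2 = z≤n ; z0≤1 = s≤s z≤n ; a10≤2 = z≤n ; z0≥1⇒ = z0≥1⇒ } with z0≥1⇒ (s≤s z≤n)
  ... | refl , refl , refl = at-most-2 (s≤s z≤n)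
  total-bound record { a01≤2 = z≤n ; z0≤1 = s≤s z≤n ; a10≤2 = s≤s z≤n ; z0≥1⇒ = z0≥1⇒ } with z0≥1⇒ (s≤s z≤n)
  ... | refl , refl , refl = at-most-2 ℕₚ.≤-refl
  total-bound record { a01≤2 = z≤n ; z0≤1 = z≤n ; zm≤1 = s≤s z≤n ; a00≤1 = a00≤1 ; zm≥1⇒ = zm≥1⇒ } with zm≥1⇒ (s≤s z≤n)
  ... | refl , refl = at-most-2 (s≤s (subst (_≤ 1) (sym (ℕₚ.+-identityʳ _)) a00≤1))
  total-bound record { a01≤2 = z≤n ; z0≤1 = z≤n ; zm≤1 = z≤n ; a10≤2 = s≤s (s≤s z≤n) ; a11≤1 = z≤n ; a10≡2⇒ = a10≡2⇒ }
    with a10≡2⇒ refl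
  ... | refl , _ , _ = at-most-2 ℕₚ.≤-refl
  total-bound record { a01≤2 = z≤n ; z0≤1 = z≤n ; zm≤1 = z≤n ; a10≤2 = s≤s (s≤s z≤n) ; a11≤1 = s≤s z≤n ; a10≡2⇒ = a10≡2⇒ }
    with a10≡2⇒ refl
  ... | refl , _ , _ = ℕₚ.≤-refl , λ _ → inj₁ (refl , refl)
  total-bound record { a01≤2 = z≤n ; z0≤1 = z≤n ; zm≤1 = z≤n ; a10≤2 = z≤n ; a00≤1 = a00≤1 ; a11≤1 = a11≤1 } =
    map₂ (λ all-one → inj₂ ∘ reorder ∘ all-one) (three-bits z≤n a00≤1 a11≤1)
  total-bound record { a01≤2 = z≤n ; z0≤1 = z≤n ; zm≤1 = z≤n ; a10≤2 = s≤s z≤n ; a00≤1 = a00≤1 ; a11≤1 = a11≤1 } =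
    map₂ (λ all-one → inj₂ ∘ reorder ∘ all-one) (three-bits (s≤s z≤n) a00≤1 a11≤1)

  module _ {a00 a01 a10 a11 z0 zm : ℕ} (ex : Exclusions a00 a01 a10 a11 z0 zm) where
    open Exclusions ex

    private
      n≡0 : ∀ {n} → ¬ (1 ≤ n) → n ≡ 0
      n≡0 ¬1≤n = ℕₚ.n<1⇒n≡0 (ℕₚ.≰⇒> ¬1≤n)

      a10≢0⇒a01≡0 : a10 ≢ 0 → a01 ≡ 0
      a10≢0⇒a01≡0 a10≢0 = n≡0 (λ 1≤a01 → a10≢0 (proj₁ (proj₂ (a01≥1⇒ 1≤a01))))

      a00≢0⇒a01≡0 : a00 ≢ 0 → a01 ≡ 0
      a00≢0⇒a01≡0 a00≢0 = n≡0 (λ 1≤a01 → a00≢0 (proj₁ (a01≥1⇒ 1≤a01)))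

    exclusions⇒profile :
      let d = a01 + (z0 + (zm + (a10 + (a00 + a11)))) in
        (d ≤ 3)
      × (d ≡ 3 ⇔ ((a10 ≡ 2 × a11 ≡ 1) ⊎ (a00 ≡ 1 × a11 ≡ 1 × a10 ≡ 1)))
      × ((a10 ≡ 2 × a11 ≡ 1) → (a00 ≡ 0 × a01 ≡ 0))
      × ((a00 ≡ 1 × a11 ≡ 1 × a10 ≡ 1) → a01 ≡ 0)
    exclusions⇒profile = proj₁ (total-bound ex) , mk⇔ (proj₂ (total-bound ex)) maximal⇒3 , case₁ , case₂
      where
      case₁ : (a10 ≡ 2 × a11 ≡ 1) → (a00 ≡ 0 × a01 ≡ 0)
      case₁ (a10≡2 , _) = proj₁ (a10≡2⇒ a10≡2) , a10≢0⇒a01≡0 (λ a10≡0 → ℕₚ.1+n≢0 (trans (sym a10≡2) a10≡0))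
      case₂ : (a00 ≡ 1 × a11 ≡ 1 × a10 ≡ 1) → a01 ≡ 0
      case₂ (a00≡1 , _) = a00≢0⇒a01≡0 (λ a00≡0 → ℕₚ.1+n≢0 (trans (sym a00≡1) a00≡0))
      maximal⇒3 : (a10 ≡ 2 × a11 ≡ 1) ⊎ (a00 ≡ 1 × a11 ≡ 1 × a10 ≡ 1) → a01 + (z0 + (zm + (a10 + (a00 + a11)))) ≡ 3
      maximal⇒3 (inj₁ max@(refl , refl)) with a10≡2⇒ refl | case₁ max
      ... | refl , refl , refl | _ , refl = refl
      maximal⇒3 (inj₂ max@(refl , refl , refl))
        with case₂ max | n≡0 (λ 1≤z0 → ℕₚ.1+n≢0 (proj₁ (z0≥1⇒ 1≤z0)))
                       | n≡0 (λ 1≤zm → ℕₚ.1+n≢0 (proj₁ (zm≥1⇒ 1≤zm)))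
      ... | refl | refl | refl = refl

module ClassCounts (𝔽 : FiniteField) (q≡7 : FiniteField.q 𝔽 % 8 ≡ 7) (b : FiniteField.Carrier 𝔽) where
  open FiniteField 𝔽
  open FieldLemmas 𝔽
  open Counting 𝔽
  open FilterLength using (length-filter-mono)
  open QuadraticResidues 𝔽 q≡7
  open Differences 𝔽 q≡7
  open Collisions 𝔽 q≡7
  open ExclusionTable using (Exclusions)
  open ≡ using (refl; sym; trans; cong; cong₂; module ≡-Reasoning)
  open ≡-Reasoning

  β : Carrier
  β = ⅔ ⁻¹ * b

  ⅔*v≡b⇒v≡β : ∀ {v} → ⅔ * v ≡ b → v ≡ β
  ⅔*v≡b⇒v≡β {v} ⅔v≡b = *-cancelˡ ⅔≢0 (begin
    ⅔ * v             ≡⟨ ⅔v≡b ⟩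
    b                 ≡⟨ solve 1 (λ b → b := κ 1 :* b) refl b ⟩
    1# * b            ≡⟨ cong (_* b) (⁻¹-inverse ⅔ ⅔≢0) ⟨
    (⅔ * ⅔ ⁻¹) * b    ≡⟨ *-assoc ⅔ (⅔ ⁻¹) b ⟩
    ⅔ * β             ∎)

  InClass : ℤ.ℤ → ℤ.ℤ → Pred Carrier 0ℓ
  InClass e₀ e₁ x = η x ≡ e₀ × η (x + 1#) ≡ e₁ × Δ x ≡ b

  inClass? : ∀ e₀ e₁ → Decidable (InClass e₀ e₁)
  inClass? e₀ e₁ x = (η x ℤ.≟ e₀) ×-dec ((η (x + 1#) ℤ.≟ e₁) ×-dec (Δ x ≟ b))

  -- The decision procedure inside #A is local to Defs, so it can only be found by unification at the list level.
  #A≡count : ∀ e₀ e₁ → #A e₀ e₁ b ≡ count (inClass? e₀ e₁)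
  #A≡count e₀ e₁ = ℕₚ.≤-antisym (length-filter-mono _ (inClass? e₀ e₁ ∘ elt) id (allFin q))
                                  (length-filter-mono (inClass? e₀ e₁ ∘ elt) _ id (allFin q))

  A00? : Decidable (InClass ℤ.1ℤ ℤ.1ℤ)
  A01? : Decidable (InClass ℤ.1ℤ ℤ.-1ℤ)
  A10? : Decidable (InClass ℤ.-1ℤ ℤ.1ℤ)
  A11? : Decidable (InClass ℤ.-1ℤ ℤ.-1ℤ)
  A00? = inClass? ℤ.1ℤ ℤ.1ℤ
  A01? = inClass? ℤ.1ℤ ℤ.-1ℤ
  A10? = inClass? ℤ.-1ℤ ℤ.1ℤ
  A11? = inClass? ℤ.-1ℤ ℤ.-1ℤ

  at0? : Decidable (λ x → x ≡ 0# × Δ x ≡ b)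
  at-1? : Decidable (λ x → x ≡ - 1# × Δ x ≡ b)
  at0?  x = (x ≟ 0#) ×-dec (Δ x ≟ b)
  at-1? x = (x ≟ - 1#) ×-dec (Δ x ≟ b)

  E≡β : ∀ {x v} → Δ x ≡ ⅔ * v → Δ x ≡ b → v ≡ β
  E≡β Δx≡⅔v Δx≡b = ⅔*v≡b⇒v≡β (trans (sym Δx≡⅔v) Δx≡b)

  in-00 : ∀ {x} → InClass ℤ.1ℤ ℤ.1ℤ x → Residue x × Residue (x + 1#) × E00 x ≡ β
  in-00 (ηx≡1 , ηx+1≡1 , Δx≡b) =
    η≡1⇒residue ηx≡1 , η≡1⇒residue ηx+1≡1 , E≡β (Δ-00 (η≡1⇒residue ηx≡1) (η≡1⇒residue ηx+1≡1)) Δx≡b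

  in-01 : ∀ {x} → InClass ℤ.1ℤ ℤ.-1ℤ x → Residue x × ¬ IsSquare (x + 1#) × E01 x ≡ β
  in-01 (ηx≡1 , ηx+1≡-1 , Δx≡b) =
    η≡1⇒residue ηx≡1 , η≡-1⇒nonsquare ηx+1≡-1 , E≡β (Δ-01 (η≡1⇒residue ηx≡1) (η≡-1⇒nonsquare ηx+1≡-1)) Δx≡b

  in-10 : ∀ {x} → InClass ℤ.-1ℤ ℤ.1ℤ x → ¬ IsSquare x × Residue (x + 1#) × E10 x ≡ β
  in-10 (ηx≡-1 , ηx+1≡1 , Δx≡b) =
    η≡-1⇒nonsquare ηx≡-1 , η≡1⇒residue ηx+1≡1 , E≡β (Δ-10 (η≡-1⇒nonsquare ηx≡-1) (η≡1⇒residue ηx+1≡1)) Δx≡b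

  in-11 : ∀ {x} → InClass ℤ.-1ℤ ℤ.-1ℤ x → ¬ IsSquare x × ¬ IsSquare (x + 1#) × E11 x ≡ β
  in-11 (ηx≡-1 , ηx+1≡-1 , Δx≡b) =
    η≡-1⇒nonsquare ηx≡-1 , η≡-1⇒nonsquare ηx+1≡-1 , E≡β (Δ-11 (η≡-1⇒nonsquare ηx≡-1) (η≡-1⇒nonsquare ηx+1≡-1)) Δx≡b

  at0⇒ : ∀ {x} → x ≡ 0# × Δ x ≡ b → 2# ≡ β
  at0⇒ (refl , Δ0≡b) = E≡β Δ-0# Δ0≡b

  at-1⇒ : ∀ {x} → x ≡ - 1# × Δ x ≡ b → - 1# ≡ β
  at-1⇒ (refl , Δ-1≡b) = E≡β Δ-[-1#] Δ-1≡b

  private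
    E00≡β : ∀ {x} → InClass ℤ.1ℤ ℤ.1ℤ x → E00 x ≡ β
    E00≡β = proj₂ ∘ proj₂ ∘ in-00
    E01≡β : ∀ {x} → InClass ℤ.1ℤ ℤ.-1ℤ x → E01 x ≡ β
    E01≡β = proj₂ ∘ proj₂ ∘ in-01
    E10≡β : ∀ {x} → InClass ℤ.-1ℤ ℤ.1ℤ x → E10 x ≡ β
    E10≡β = proj₂ ∘ proj₂ ∘ in-10
    E11≡β : ∀ {x} → InClass ℤ.-1ℤ ℤ.-1ℤ x → E11 x ≡ β
    E11≡β = proj₂ ∘ proj₂ ∘ in-11

  A01-inhabited : 0 ℕ.< count A01? → count A00? ≡ 0 × count A10? ≡ 0 × count at0? ≡ 0 × count at-1? ≡ 0
  A01-inhabited 0<#A01 =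
    let (_ , p) = count>0⇒∃ A01? 0<#A01
        (_ , ¬□x+1 , E01x≡β) = in-01 p
    in  count-none A00? (λ _ pw → E01≢E00 (proj₁ (in-00 pw)) (trans E01x≡β (sym (E00≡β pw))))
      , count-none A10? (λ _ py → E01≢E10 ¬□x+1 (proj₁ (in-10 py)) (trans E01x≡β (sym (E10≡β py))))
      , count-none at0? (λ _ p0 → E01≢2 ¬□x+1 (trans E01x≡β (sym (at0⇒ p0))))
      , count-none at-1? (λ _ p-1 → E01≢-1 ¬□x+1 (trans E01x≡β (sym (at-1⇒ p-1))))

  A01-full : count A01? ≡ 2 → count A11? ≡ 0
  A01-full #A01≡2 =
    let (x₁ , x₂ , p₁ , p₂ , x₁≢x₂) = count≡2⇒distinct A01? #A01≡2
        ((_ , □x₁) , _ , E01x₁≡β) = in-01 p₁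
        mirror : x₁ - 1# ≡ - (x₂ - 1#)
        mirror = E01-mirror x₁≢x₂ (trans E01x₁≡β (sym (E01≡β p₂)))
    in  count-none A11? λ _ pz →
          E01-pair≢E11 □x₁ (proj₂ (proj₁ (in-01 p₂))) mirror (proj₁ (in-11 pz)) (trans E01x₁≡β (sym (E11≡β pz)))

  A10-full : count A10? ≡ 2 → count A00? ≡ 0 × count at0? ≡ 0 × count at-1? ≡ 0
  A10-full #A10≡2 =
    let (y₁ , y₂ , p₁ , p₂ , y₁≢y₂) = count≡2⇒distinct A10? #A10≡2
        (¬□y₁ , (y₁+1≢0 , _) , E10y₁≡β) = in-10 p₁
        (¬□y₂ , (y₂+1≢0 , _) , E10y₂≡β) = in-10 p₂
        mirror : y₁ + 2# ≡ - (y₂ + 2#)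
        mirror = E10-mirror y₁≢y₂ (trans E10y₁≡β (sym E10y₂≡β))
    in  count-none A00? (λ _ pw → E10-pair≢E00 ¬□y₁ ¬□y₂ mirror (proj₁ (in-00 pw)) (trans E10y₁≡β (sym (E00≡β pw))))
      , count-none at0? (λ _ p0 → E10-pair≢2 (nonsquare⇒≢0 ¬□y₁) (nonsquare⇒≢0 ¬□y₂) mirror (trans E10y₁≡β (sym (at0⇒ p0))))
      , count-none at-1? (λ _ p-1 → E10-pair≢-1 y₁+1≢0 y₂+1≢0 mirror (trans E10y₁≡β (sym (at-1⇒ p-1))))

  0-solution : 0 ℕ.< count at0? → count A00? ≡ 0 × count A11? ≡ 0 × count at-1? ≡ 0
  0-solution 0<#at0 =
      count-none A00? (λ _ pw → E00≢2 (proj₁ (proj₁ (in-00 pw))) (trans (E00≡β pw) (sym 2≡β)))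
    , count-none A11? (λ _ pw → E11≢2 (proj₁ (in-11 pw)) (trans (E11≡β pw) (sym 2≡β)))
    , count-none at-1? (λ _ p-1 → 2#≢-1 (trans 2≡β (sym (at-1⇒ p-1))))
    where
    2≡β : 2# ≡ β
    2≡β = at0⇒ (proj₂ (count>0⇒∃ at0? 0<#at0))

  -1-solution : 0 ℕ.< count at-1? → count A10? ≡ 0 × count A11? ≡ 0
  -1-solution 0<#at-1 =
      count-none A10? (λ _ py → E10≢-1 (proj₁ (proj₂ (in-10 py))) (trans (E10≡β py) (sym -1≡β)))
    , count-none A11? (λ _ pw → E11≢-1 (proj₁ (proj₂ (in-11 pw))) (trans (E11≡β pw) (sym -1≡β)))
    where
    -1≡β : - 1# ≡ β
    -1≡β = at-1⇒ (proj₂ (count>0⇒∃ at-1? 0<#at-1))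

  exclusions : Exclusions (count A00?) (count A01?) (count A10?) (count A11?) (count at0?) (count at-1?)
  exclusions = record
    { a00≤1 = count≤1 A00? (λ p p′ → E00-injective (trans (E00≡β p) (sym (E00≡β p′))))
    ; a01≤2 = count≤2 A01? (λ p p′ p″ → E01-collision (trans (E01≡β p) (sym (E01≡β p′))) (trans (E01≡β p) (sym (E01≡β p″))))
    ; a10≤2 = count≤2 A10? (λ p p′ p″ → E10-collision (trans (E10≡β p) (sym (E10≡β p′))) (trans (E10≡β p) (sym (E10≡β p″))))
    ; a11≤1 = count≤1 A11? (λ p p′ → E11-injective (trans (E11≡β p) (sym (E11≡β p′))))
    ; z0≤1  = count≤1 at0? (λ (x≡0 , _) (y≡0 , _) → trans x≡0 (sym y≡0))
    ; zm≤1  = count≤1 at-1? (λ (x≡-1 , _) (y≡-1 , _) → trans x≡-1 (sym y≡-1))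
    ; a01≥1⇒ = A01-inhabited
    ; a01≡2⇒ = A01-full
    ; a10≡2⇒ = A10-full
    ; z0≥1⇒  = 0-solution
    ; zm≥1⇒  = -1-solution
    }

  private
    solution? : Decidable (λ x → Δ x ≡ b)
    solution? x = Δ x ≟ b

    η≟ : ∀ e → Decidable (λ x → η x ≡ e)
    η+1≟ : ∀ e → Decidable (λ x → η (x + 1#) ≡ e)
    η≟ e x = η x ℤ.≟ e
    η+1≟ e x = η (x + 1#) ℤ.≟ e

    ≡-1⇒≢1 : ∀ {i} → i ≡ ℤ.-1ℤ → i ≢ ℤ.1ℤ
    ≡-1⇒≢1 refl ()

    η0≢1 : η 0# ≢ ℤ.1ℤ
    η0≢1 η0≡1 with () ← trans (sym η-0#) η0≡1

    η0≢-1 : η 0# ≢ ℤ.-1ℤ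
    η0≢-1 η0≡-1 with () ← trans (sym η-0#) η0≡-1

    η-1≡-1 : η (- 1#) ≡ ℤ.-1ℤ
    η-1≡-1 = η-nonsquare -1-nonsquare

    η[-1+1]≡η0 : η (- 1# + 1#) ≡ η 0#
    η[-1+1]≡η0 = cong η (-‿inverseˡ 1#)

    x+1≡0⇒x≡-1 : ∀ {x} → x + 1# ≡ 0# → x ≡ - 1#
    x+1≡0⇒x≡-1 {x} x+1≡0 = begin
      x                ≡⟨ solve 1 (λ x → x := (x :+ κ 1) :- κ 1) refl x ⟩
      (x + 1#) - 1#    ≡⟨ cong (_- 1#) x+1≡0 ⟩
      0# - 1#          ≡⟨ +-identityˡ _ ⟩
      - 1#             ∎

    η≢±1⇒≡0 : ∀ {y} → η y ≢ ℤ.1ℤ → η y ≢ ℤ.-1ℤ → y ≡ 0#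
    η≢±1⇒≡0 {y} ηy≢1 ηy≢-1 with character y
    ... | zero y≡0      = y≡0
    ... | residue ry    = ⊥-elim (ηy≢1 (η-residue ry))
    ... | nonsquare ¬□y = ⊥-elim (ηy≢-1 (η-nonsquare ¬□y))

    η≡1⇒η+1≢1⇒η+1≡-1 : ∀ {x} → η x ≡ ℤ.1ℤ → η (x + 1#) ≢ ℤ.1ℤ → η (x + 1#) ≡ ℤ.-1ℤ
    η≡1⇒η+1≢1⇒η+1≡-1 {x} ηx≡1 ηx+1≢1 with η (x + 1#) ℤ.≟ ℤ.-1ℤ
    ... | yes ηx+1≡-1 = ηx+1≡-1
    ... | no ηx+1≢-1  = ⊥-elim (≡-1⇒≢1 (trans (cong η (x+1≡0⇒x≡-1 (η≢±1⇒≡0 ηx+1≢1 ηx+1≢-1))) η-1≡-1) ηx≡1)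

  δF≡sum : δF b ≡ count A01? ℕ.+ (count at0? ℕ.+ (count at-1? ℕ.+ (count A10? ℕ.+ (count A00? ℕ.+ count A11?))))
  δF≡sum = begin
    count solution?
      ≡⟨ count-split solution? (η≟ ℤ.1ℤ) ⟩
    count S₁ ℕ.+ count S₋
      ≡⟨ cong₂ ℕ._+_ #S₁ (trans #S₋ (cong (ℕ._+ count at0?) (trans #S₋₋ (cong (count A10? ℕ.+_) #S₋₋₋)))) ⟩
    (count A00? ℕ.+ count A01?) ℕ.+ ((count A10? ℕ.+ (count A11? ℕ.+ count at-1?)) ℕ.+ count at0?)
      ≡⟨ rearrange (count A00?) (count A01?) (count A10?) (count A11?) (count at0?) (count at-1?) ⟩
    count A01? ℕ.+ (count at0? ℕ.+ (count at-1? ℕ.+ (count A10? ℕ.+ (count A00? ℕ.+ count A11?)))) ∎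
    where
    rearrange : ∀ a00 a01 a10 a11 z0 zm → (a00 ℕ.+ a01) ℕ.+ ((a10 ℕ.+ (a11 ℕ.+ zm)) ℕ.+ z0)
                                         ≡ a01 ℕ.+ (z0 ℕ.+ (zm ℕ.+ (a10 ℕ.+ (a00 ℕ.+ a11))))
    rearrange = solve-∀
    S₁ : Decidable (λ x → Δ x ≡ b × η x ≡ ℤ.1ℤ)
    S₁ = solution? ∩? η≟ ℤ.1ℤ
    S₋ : Decidable (λ x → Δ x ≡ b × η x ≢ ℤ.1ℤ)
    S₋ = solution? ∩? ∁? (η≟ ℤ.1ℤ)
    S₋₋ : Decidable (λ x → (Δ x ≡ b × η x ≢ ℤ.1ℤ) × η x ≡ ℤ.-1ℤ)
    S₋₋ = S₋ ∩? η≟ ℤ.-1ℤ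
    S₋₋₋ : Decidable (λ x → ((Δ x ≡ b × η x ≢ ℤ.1ℤ) × η x ≡ ℤ.-1ℤ) × η (x + 1#) ≢ ℤ.1ℤ)
    S₋₋₋ = S₋₋ ∩? ∁? (η+1≟ ℤ.1ℤ)
    #S₁ : count S₁ ≡ count A00? ℕ.+ count A01?
    #S₁ = count-partition S₁ (η+1≟ ℤ.1ℤ) A00? A01?
      (λ ((Δ≡b , ηx≡1) , ηx+1≡1) → ηx≡1 , ηx+1≡1 , Δ≡b)
      (λ (ηx≡1 , ηx+1≡1 , Δ≡b) → (Δ≡b , ηx≡1) , ηx+1≡1)
      (λ ((Δ≡b , ηx≡1) , ηx+1≢1) → ηx≡1 , η≡1⇒η+1≢1⇒η+1≡-1 ηx≡1 ηx+1≢1 , Δ≡b)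
      (λ (ηx≡1 , ηx+1≡-1 , Δ≡b) → (Δ≡b , ηx≡1) , ≡-1⇒≢1 ηx+1≡-1)
    #S₋ : count S₋ ≡ count S₋₋ ℕ.+ count at0?
    #S₋ = count-partition S₋ (η≟ ℤ.-1ℤ) S₋₋ at0? id id
      (λ ((Δ≡b , ηx≢1) , ηx≢-1) → η≢±1⇒≡0 ηx≢1 ηx≢-1 , Δ≡b)
      (λ { (refl , Δ≡b) → (Δ≡b , η0≢1) , η0≢-1 })
    #S₋₋ : count S₋₋ ≡ count A10? ℕ.+ count S₋₋₋
    #S₋₋ = count-partition S₋₋ (η+1≟ ℤ.1ℤ) A10? S₋₋₋
      (λ (((Δ≡b , _) , ηx≡-1) , ηx+1≡1) → ηx≡-1 , ηx+1≡1 , Δ≡b)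
      (λ (ηx≡-1 , ηx+1≡1 , Δ≡b) → ((Δ≡b , ≡-1⇒≢1 ηx≡-1) , ηx≡-1) , ηx+1≡1)
      id id
    #S₋₋₋ : count S₋₋₋ ≡ count A11? ℕ.+ count at-1?
    #S₋₋₋ = count-partition S₋₋₋ (η+1≟ ℤ.-1ℤ) A11? at-1?
      (λ ((((Δ≡b , _) , ηx≡-1) , _) , ηx+1≡-1) → ηx≡-1 , ηx+1≡-1 , Δ≡b)
      (λ (ηx≡-1 , ηx+1≡-1 , Δ≡b) → (((Δ≡b , ≡-1⇒≢1 ηx≡-1) , ηx≡-1) , ≡-1⇒≢1 ηx+1≡-1) , ηx+1≡-1)
      (λ ((((Δ≡b , _) , _) , ηx+1≢1) , ηx+1≢-1) → x+1≡0⇒x≡-1 (η≢±1⇒≡0 ηx+1≢1 ηx+1≢-1) , Δ≡b)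
      (λ { (refl , Δ≡b) → (((Δ≡b , ≡-1⇒≢1 η-1≡-1) , η-1≡-1) , η0≢1 ∘ trans (sym η[-1+1]≡η0)) , η0≢-1 ∘ trans (sym η[-1+1]≡η0) })

open ExclusionTable using (exclusions⇒profile)
open ClassCounts using (#A≡count; δF≡sum; exclusions)

corollary3 : (𝔽 : FiniteField) → FiniteField.q 𝔽 % 8 ≡ 7 →
    let open FiniteField 𝔽 in
    (b : Carrier) →
      (δF b ≤ 3)
      × (δF b ≡ 3 ⇔ ((#A10 b ≡ 2 × #A11 b ≡ 1) ⊎ (#A00 b ≡ 1 × #A11 b ≡ 1 × #A10 b ≡ 1)))
      × ((#A10 b ≡ 2 × #A11 b ≡ 1) → (#A00 b ≡ 0 × #A01 b ≡ 0))
      × ((#A00 b ≡ 1 × #A11 b ≡ 1 × #A10 b ≡ 1) → #A01 b ≡ 0)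
corollary3 𝔽 q≡7 b
  rewrite #A≡count 𝔽 q≡7 b ℤ.1ℤ ℤ.1ℤ | #A≡count 𝔽 q≡7 b ℤ.1ℤ ℤ.-1ℤ
        | #A≡count 𝔽 q≡7 b ℤ.-1ℤ ℤ.1ℤ | #A≡count 𝔽 q≡7 b ℤ.-1ℤ ℤ.-1ℤ
        | δF≡sum 𝔽 q≡7 b
  = exclusions⇒profile (exclusions 𝔽 q≡7 b)
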